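{- Let $G$ be a connected graph. For each spanning tree $T$ of $G$, let $H[T]$ be the local basis exchange graph of $G$ with respect to $T$. Then $$T_G(x,y)=\sum_{T\in \mathcal{T}(G)}\widetilde{T}_{H[T]}(x,y),$$ where $\mathcal{T}(G)$ is the set of spanning trees of $G$.
   Context: For a graph $G=(V,E)$ (loops and multiple edges allowed), the Tutte polynomial is $T_G(x,y)=\sum_{A'\subseteq E}(x-1)^{k(A')-k(E)}(y-1)^{k(A')+|A'|-|V|}$, where $k(A')$ is the number of components of $(V,A')$. For a spanning tree $T$ of $G$, the local basis exchange graph $H[T]$ is the bipartite graph with vertex set $E$, with sides $A=E(T)$ and $B=E\setminus E(T)$, in which $e\in E(T)$ is adjacent to $f\in E\setminus E(T)$ iff $f$ lies in the cut determined by removing $e$ from $T$ (equivalently, $e$ lies on the cycle of $T+f$). For a bipartite graph $H=(A,B,E_H)$ with designated sides $A,B$ and $m$ vertices, and a permutation $\pi$ of $V(H)$ (a bijection to $[m]$), a vertex $i\in A$ is internally active if $\pi(i)>\pi(j)$ for all neighbours $j$ of $i$, and $j\in B$ is externally active if $\pi(j)>\pi(i)$ for all neighbours $i$ of $j$ (vacuous for isolated vertices); $\mathrm{ia}(\pi),\mathrm{ea}(\pi)$ are their numbers, and $\widetilde{T}_H(x,y)=\frac{1}{m!}\sum_{\pi}x^{\mathrm{ia}(\pi)}y^{\mathrm{ea}(\pi)}$. -}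

module Defs where

open import Data.Bool using (Bool; true; false; _∧_; _∨_; not; if_then_else_)
open import Data.Nat using (ℕ; zero; suc; _∸_; _<ᵇ_; _!) renaming (_+_ to _+ℕ_)
open import Data.Nat.Properties using (_!≢0)
open import Data.Fin using (Fin; toℕ; _≟_)
open import Data.Product using (_×_; _,_)
open import Data.List using (List; []; _∷_; map; concatMap; foldr; filter; allFin)
open import Data.Vec using (Vec; []; _∷_; lookup; replicate; _[_]≔_)
open import Data.Integer using (+_)
open import Data.Rational using (ℚ; 0ℚ; 1ℚ; _+_; _*_; _-_; _/_)
open import Relation.Nullary.Decidable using (⌊_⌋)
open import Data.Nat using () renaming (_≟_ to _≟ℕ_)
open import Data.Bool using () renaming (_≟_ to _≟B_)

allVecs : {A : Set} → List A → (k : ℕ) → List (Vec A k)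
allVecs xs zero    = [] ∷ []
allVecs xs (suc k) = concatMap (λ x → map (x ∷_) (allVecs xs k)) xs

anyFin : (n : ℕ) → (Fin n → Bool) → Bool
anyFin n p = foldr (λ i b → p i ∨ b) false (allFin n)

allFinB : (n : ℕ) → (Fin n → Bool) → Bool
allFinB n p = foldr (λ i b → p i ∧ b) true (allFin n)

countFin : (n : ℕ) → (Fin n → Bool) → ℕ
countFin n p = foldr (λ i c → if p i then suc c else c) 0 (allFin n)

_⇒ᵇ_ : Bool → Bool → Bool
a ⇒ᵇ b = not a ∨ b

_==_ : {n : ℕ} → Fin n → Fin n → Bool
i == j = ⌊ i ≟ j ⌋

sumℚ : List ℚ → ℚ
sumℚ = foldr _+_ 0ℚ

powℚ : ℚ → ℕ → ℚ
powℚ q zero    = 1ℚ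
powℚ q (suc k) = q * powℚ q k

-- Graphs: n vertices (Fin n), m edges (Fin m); each edge has a pair of
-- endpoints.  Loops (equal endpoints) and parallel edges are allowed.

Graph : ℕ → ℕ → Set
Graph n m = Fin m → Fin n × Fin n

EdgeSet : ℕ → Set
EdgeSet m = Vec Bool m

allEdges : (m : ℕ) → EdgeSet m
allEdges m = replicate m true

allEdgeSets : (m : ℕ) → List (EdgeSet m)
allEdgeSets m = allVecs (true ∷ false ∷ []) m

size : {m : ℕ} → EdgeSet m → ℕ
size {m} A = countFin m (lookup A)

removeEdge : {m : ℕ} → EdgeSet m → Fin m → EdgeSet m
removeEdge A e = A [ e ]≔ false

reachW : {n m : ℕ} → Graph n m → EdgeSet m → ℕ → Fin n → Fin n → Bool
reachW G A zero    u v = u == v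
reachW {n} {m} G A (suc k) u v =
  reachW G A k u v ∨
  anyFin m (λ e → step (G e) (lookup A e))
  where
  step : Fin n × Fin n → Bool → Bool
  step (a , b) inA = inA ∧ ((reachW G A k u a ∧ (b == v)) ∨ (reachW G A k u b ∧ (a == v)))

-- u and v lie in the same component of (V, A)  (walks of ≤ n edges suffice)
connectedIn : {n m : ℕ} → Graph n m → EdgeSet m → Fin n → Fin n → Bool
connectedIn {n} G A u v = reachW G A n u v

-- k(A): number of components of (V, A), counted as the number of vertices
-- that are the least vertex of their component
components : {n m : ℕ} → Graph n m → EdgeSet m → ℕ
components {n} G A =
  countFin n (λ v → not (anyFin n (λ u → (toℕ u <ᵇ toℕ v) ∧ connectedIn G A u v)))

-- Acyclic: every edge of T is a bridge of (V, T), i.e. its endpoints are not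
-- connected in T \ {e} (in particular T contains no loop).
isAcyclic : {n m : ℕ} → Graph n m → EdgeSet m → Bool
isAcyclic {n} {m} G T = allFinB m (λ e → lookup T e ⇒ᵇ notConn (G e) (removeEdge T e))
  where
  notConn : Fin n × Fin n → EdgeSet m → Bool
  notConn (a , b) T' = not (connectedIn G T' a b)

isSpanningTree : {n m : ℕ} → Graph n m → EdgeSet m → Bool
isSpanningTree G T = ⌊ components G T ≟ℕ 1 ⌋ ∧ isAcyclic G T

spanningTrees : {n m : ℕ} → Graph n m → List (EdgeSet m)
spanningTrees {n} {m} G = filter (λ T → isSpanningTree G T ≟B true) (allEdgeSets m)

-- Tutte polynomial, evaluated at (x, y) ∈ ℚ²:
-- T_G(x,y) = Σ_{A' ⊆ E} (x-1)^{k(A')-k(E)} (y-1)^{k(A')+|A'|-|V|}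
-- (both exponents are always ≥ 0, so truncated subtraction is exact)

tutte : {n m : ℕ} → Graph n m → ℚ → ℚ → ℚ
tutte {n} {m} G x y =
  sumℚ (map (λ A → powℚ (x - 1ℚ) (components G A ∸ components G (allEdges m))
                 * powℚ (y - 1ℚ) ((components G A +ℕ size A) ∸ n))
            (allEdgeSets m))

-- Bipartite graphs H = (A, B, E_H) on vertex set Fin m:
-- inA i = true means i ∈ A, otherwise i ∈ B; adj i j (for i ∈ A, j ∈ B)
-- says i and j are adjacent.

record BipGraph (m : ℕ) : Set where
  field
    inA : Fin m → Bool
    adj : Fin m → Fin m → Bool
open BipGraph public

-- permutations π : V(H) → [m], as injective maps Fin m → Fin m
-- (given as the vector of values)
isPerm : {m : ℕ} → Vec (Fin m) m → Bool
isPerm {m} π = allFinB m (λ i → allFinB m (λ j → (lookup π i == lookup π j) ⇒ᵇ (i == j)))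

permutations : (m : ℕ) → List (Vec (Fin m) m)
permutations m = filter (λ π → isPerm π ≟B true) (allVecs (allFin m) m)

ia : {m : ℕ} → BipGraph m → Vec (Fin m) m → ℕ
ia {m} H π = countFin m (λ i → inA H i ∧
  allFinB m (λ j → (not (inA H j) ∧ adj H i j) ⇒ᵇ (toℕ (lookup π j) <ᵇ toℕ (lookup π i))))

ea : {m : ℕ} → BipGraph m → Vec (Fin m) m → ℕ
ea {m} H π = countFin m (λ j → not (inA H j) ∧
  allFinB m (λ i → (inA H i ∧ adj H i j) ⇒ᵇ (toℕ (lookup π i) <ᵇ toℕ (lookup π j))))

tutteTilde : {m : ℕ} → BipGraph m → ℚ → ℚ → ℚ
tutteTilde {m} H x y =
  (+ 1 / (m !)) * sumℚ (map (λ π → powℚ x (ia H π) * powℚ y (ea H π)) (permutations m))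
  where instance _ = m !≢0

-- Local basis exchange graph H[T]: vertex set E, A = E(T), B = E \ E(T);
-- e ∈ T adjacent to f ∉ T iff f lies in the cut of T - e, i.e. the
-- endpoints of f are not connected in T \ {e}.

exchangeGraph : {n m : ℕ} → Graph n m → EdgeSet m → BipGraph m
exchangeGraph {n} {m} G T = record
  { inA = lookup T
  ; adj = λ e f → lookup T e ∧ not (lookup T f) ∧ inCut (G f) (removeEdge T e)
  }
  where
  inCut : Fin n × Fin n → EdgeSet m → Bool
  inCut (a , b) T' = not (connectedIn G T' a b)

-- Fix an ordering π of the edges. Tutte's activity expansion writes T_G(x, y) as the sum, over the
-- spanning trees T, of x^ia y^ea, where an edge of T is internally active when it is the π-largest edge
-- of its fundamental cut and an edge outside T is externally active when it is the π-largest edge of its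
-- fundamental cycle; these are exactly the activities of π in H[T]. Averaging this identity over all m!
-- orderings and exchanging the two sums gives the theorem.
--
-- The expansion is proved for every minor (G / C) | S at once, by deletion-contraction on the π-smallest
-- edge e₀ of S. If e₀ is a loop of G / C both sides are multiplied by y, if it is a coloop of (G / C) | S
-- they are multiplied by x, and otherwise both split as the deletion plus the contraction. Being the
-- smallest edge, e₀ never prevents another edge from being active.

module Submission where

open import Defs
open import Algebra.Bundles using (CommutativeRing)
open import Data.Bool using (Bool; true; false; _∧_; _∨_; not; if_then_else_)
open import Data.Bool using () renaming (_≟_ to _≟B_)
open import Data.Bool.Properties using (T-≡; ∨-assoc; ∨-comm; ∨-identityʳ; ∧-comm; ∧-identityʳ; ∧-zeroʳ)
open import Data.Empty using (⊥; ⊥-elim)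
open import Data.Fin using (Fin; toℕ; _≟_) renaming (zero to fz; suc to fs)
open import Data.Fin.Properties using (suc-injective; toℕ-injective; toℕ<n)
open import Data.Fin.Subset using (_∪_) renaming (⊥ to ∅)
import Data.Integer as ℤ
import Data.Integer.Properties as ℤ
open import Data.List using (List; []; _∷_; map; _++_; concat; concatMap; filter; foldr; allFin)
open import Data.List.Properties using (map-tabulate; foldr-map)
open import Data.Nat using (ℕ; zero; suc; _≤_; _<_; z≤n; s≤s; _<ᵇ_; _≤ᵇ_; _∸_; _!; NonZero)
  renaming (_+_ to _+ℕ_; _*_ to _*ℕ_; _≟_ to _≟ℕ_)
open import Data.Nat.Combinatorics using (nPn≡n!)
open import Data.Nat.Combinatorics.Base using (_P′_)
open import Data.Nat.Properties
  using (≤-refl; ≤-trans; ≤-reflexive; <-irrefl; <-trans; ≤-<-trans; <-cmp; <⇒≤; m≤n⇒m≤1+n; m≤m+n; n≤1+n;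
         ≤∧≢⇒<; m∸n+n≡m; m+n∸n≡m; n∸n≡0; +-monoˡ-≤; <ᵇ⇒<; <⇒<ᵇ; ≤ᵇ⇒≤; ≤⇒≤ᵇ; _!≢0)
import Data.Nat.Properties as ℕ
open import Data.Product using (_×_; _,_; ∃; proj₁; proj₂)
open import Data.Rational using (ℚ; 0ℚ; 1ℚ; _+_; _*_; _-_; _/_; toℚᵘ)
open import Data.Rational.Properties
  using (+-*-commutativeRing; +-assoc; +-identityˡ; +-identityʳ; *-identityˡ; *-assoc; *-distribˡ-+; *-zeroʳ;
         toℚᵘ-injective; toℚᵘ-homo-+; toℚᵘ-homo-*; toℚᵘ-fromℚᵘ)
open import Data.Rational.Solver using (module +-*-Solver)
import Data.Rational.Unnormalised as ℚᵘ
import Data.Rational.Unnormalised.Properties as ℚᵘ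
open import Data.Sum using (_⊎_; inj₁; inj₂; [_,_]′)
open import Data.Vec using (Vec; []; _∷_; lookup; replicate; tabulate; _[_]≔_)
open import Data.Vec.Properties
  using (lookup∘update; lookup∘update′; lookup-zipWith; lookup-replicate; lookup∘tabulate; tabulate∘lookup;
         tabulate-cong)
open import Function using (id; case_of_)
open import Function.Bundles using (module Equivalence)
open import Relation.Binary using (tri<; tri≈; tri>)
open import Relation.Binary.PropositionalEquality
open import Relation.Nullary using (¬_; yes; no)
open import Relation.Nullary.Decidable using (⌊_⌋)

open import Algebra.Properties.Semiring.Mult (CommutativeRing.semiring +-*-commutativeRing)
  using (×-assocˡ; ×-assoc-*) renaming (_×_ to _·_)
open +-*-Solver using (solve; _:+_; _:*_; _:-_; _:=_; con)

-- Boolean reflection and counting over Fin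

∨-true⁻ : ∀ {a b} → a ∨ b ≡ true → a ≡ true ⊎ b ≡ true
∨-true⁻ {true}  _ = inj₁ refl
∨-true⁻ {false} p = inj₂ p

∨-trueˡ : ∀ {a} b → a ≡ true → a ∨ b ≡ true
∨-trueˡ b refl = refl

∨-trueʳ : ∀ a {b} → b ≡ true → a ∨ b ≡ true
∨-trueʳ true  _ = refl
∨-trueʳ false p = p

∧-true⁻ : ∀ {a b} → a ∧ b ≡ true → a ≡ true × b ≡ true
∧-true⁻ {true} p = refl , p

∧-true⁺ : ∀ {a b} → a ≡ true → b ≡ true → a ∧ b ≡ true
∧-true⁺ refl p = p

∧-false⁺ : ∀ {a} b → a ≡ false → a ∧ b ≡ false
∧-false⁺ b refl = refl

∧-cong-when : ∀ a {p q} → (a ≡ true → p ≡ q) → a ∧ p ≡ a ∧ q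
∧-cong-when true  f = f refl
∧-cong-when false f = refl

not-true⁻ : ∀ {a} → not a ≡ true → a ≡ false
not-true⁻ {false} _ = refl

not-false⁻ : ∀ {a} → not a ≡ false → a ≡ true
not-false⁻ {true} _ = refl

true≢false : ∀ {a} → a ≡ true → a ≡ false → ⊥
true≢false refl ()

¬true⇒false : ∀ {a} → ¬ (a ≡ true) → a ≡ false
¬true⇒false {true}  p = ⊥-elim (p refl)
¬true⇒false {false} p = refl

⇒ᵇ-true⁻ : ∀ {a b} → a ⇒ᵇ b ≡ true → a ≡ true → b ≡ true
⇒ᵇ-true⁻ {true} p refl = p

⇒ᵇ-true⁺ : ∀ a {b} → (a ≡ true → b ≡ true) → a ⇒ᵇ b ≡ true
⇒ᵇ-true⁺ true  f = f refl
⇒ᵇ-true⁺ false f = refl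

⇒ᵇ-false⁻ : ∀ {a b} → a ⇒ᵇ b ≡ false → a ≡ true × b ≡ false
⇒ᵇ-false⁻ {true} {false} _ = refl , refl

⇒ᵇ-zeroʳ : ∀ a → a ⇒ᵇ true ≡ true
⇒ᵇ-zeroʳ true  = refl
⇒ᵇ-zeroʳ false = refl

Bool-ext : ∀ {a b : Bool} → (a ≡ true → b ≡ true) → (b ≡ true → a ≡ true) → a ≡ b
Bool-ext {true}          f g = sym (f refl)
Bool-ext {false} {true}  f g = g refl
Bool-ext {false} {false} f g = refl

==-refl : ∀ {k} (i : Fin k) → (i == i) ≡ true
==-refl i with i ≟ i
... | yes _ = refl
... | no ne = ⊥-elim (ne refl)

==-true⁻ : ∀ {k} {i j : Fin k} → (i == j) ≡ true → i ≡ j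
==-true⁻ {i = i} {j} p with i ≟ j
... | yes e = e

==-false : ∀ {k} {i j : Fin k} → ¬ i ≡ j → (i == j) ≡ false
==-false {i = i} {j} ne with i ≟ j
... | yes e = ⊥-elim (ne e)
... | no _ = refl

⌊≟ℕ⌋-true⁻ : ∀ {p q} → ⌊ p ≟ℕ q ⌋ ≡ true → p ≡ q
⌊≟ℕ⌋-true⁻ {p} {q} h with p ≟ℕ q
... | yes e = e

⌊≟ℕ⌋-refl : ∀ p → ⌊ p ≟ℕ p ⌋ ≡ true
⌊≟ℕ⌋-refl p with p ≟ℕ p
... | yes _ = refl
... | no ne = ⊥-elim (ne refl)

⌊≟ℕ⌋-false : ∀ {p q} → ¬ p ≡ q → ⌊ p ≟ℕ q ⌋ ≡ false
⌊≟ℕ⌋-false {p} {q} ne with p ≟ℕ q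
... | yes e = ⊥-elim (ne e)
... | no _ = refl

<ᵇ-true⁻ : ∀ {a b} → (a <ᵇ b) ≡ true → a < b
<ᵇ-true⁻ {a} {b} h = <ᵇ⇒< a b (Equivalence.from T-≡ h)

<ᵇ-true⁺ : ∀ {a b} → a < b → (a <ᵇ b) ≡ true
<ᵇ-true⁺ {a} {b} lt with a <ᵇ b | <⇒<ᵇ lt
... | true | _ = refl

<ᵇ-false⁺ : ∀ {a b} → ¬ a < b → (a <ᵇ b) ≡ false
<ᵇ-false⁺ nlt = ¬true⇒false λ h → nlt (<ᵇ-true⁻ h)

≤ᵇ-true⁻ : ∀ {a b} → (a ≤ᵇ b) ≡ true → a ≤ b
≤ᵇ-true⁻ {a} {b} h = ≤ᵇ⇒≤ a b (Equivalence.from T-≡ h)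

≤ᵇ-true⁺ : ∀ {a b} → a ≤ b → (a ≤ᵇ b) ≡ true
≤ᵇ-true⁺ {a} {b} le with a ≤ᵇ b | ≤⇒≤ᵇ le
... | true | _ = refl

≤ᵇ-false⁺ : ∀ {a b} → ¬ a ≤ b → (a ≤ᵇ b) ≡ false
≤ᵇ-false⁺ nle = ¬true⇒false λ h → nle (≤ᵇ-true⁻ h)

foldr-allFin-suc : ∀ {B : Set} n (g : Fin (suc n) → B → B) (z : B) →
  foldr g z (allFin (suc n)) ≡ g fz (foldr (λ i → g (fs i)) z (allFin n))
foldr-allFin-suc n g z =
  cong (g fz) (trans (cong (foldr g z) (sym (map-tabulate id fs))) (foldr-map g fs z (allFin n)))

anyFin-suc : ∀ n (p : Fin (suc n) → Bool) → anyFin (suc n) p ≡ p fz ∨ anyFin n (λ i → p (fs i))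
anyFin-suc n p = foldr-allFin-suc n (λ i b → p i ∨ b) false

allFinB-suc : ∀ n (p : Fin (suc n) → Bool) → allFinB (suc n) p ≡ p fz ∧ allFinB n (λ i → p (fs i))
allFinB-suc n p = foldr-allFin-suc n (λ i b → p i ∧ b) true

countFin-suc : ∀ n (p : Fin (suc n) → Bool) →
  countFin (suc n) p ≡ (if p fz then suc else id) (countFin n (λ i → p (fs i)))
countFin-suc n p = trans (foldr-allFin-suc n (λ i c → if p i then suc c else c) 0) (lemma (p fz))
  where
  lemma : ∀ b {c} → (if b then suc c else c) ≡ (if b then suc else id) c
  lemma true  = refl
  lemma false = refl

anyFin-true⁻ : ∀ n (p : Fin n → Bool) → anyFin n p ≡ true → ∃ λ i → p i ≡ true
anyFin-true⁻ (suc n) p h with ∨-true⁻ (trans (sym (anyFin-suc n p)) h)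
... | inj₁ q = fz , q
... | inj₂ q with anyFin-true⁻ n (λ i → p (fs i)) q
... | i , r = fs i , r

anyFin-true⁺ : ∀ n (p : Fin n → Bool) i → p i ≡ true → anyFin n p ≡ true
anyFin-true⁺ (suc n) p fz     q = trans (anyFin-suc n p) (∨-trueˡ _ q)
anyFin-true⁺ (suc n) p (fs i) q =
  trans (anyFin-suc n p) (∨-trueʳ (p fz) (anyFin-true⁺ n (λ j → p (fs j)) i q))

foldr-allFin-cong : ∀ {B : Set} n {g h : Fin n → B → B} (z : B) →
  (∀ i b → g i b ≡ h i b) → foldr g z (allFin n) ≡ foldr h z (allFin n)
foldr-allFin-cong zero    z eq = refl
foldr-allFin-cong (suc n) {g} {h} z eq = begin
  foldr g z (allFin (suc n))                  ≡⟨ foldr-allFin-suc n g z ⟩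
  g fz (foldr (λ i → g (fs i)) z (allFin n))  ≡⟨ cong (g fz) (foldr-allFin-cong n z (λ i → eq (fs i))) ⟩
  g fz (foldr (λ i → h (fs i)) z (allFin n))  ≡⟨ eq fz _ ⟩
  h fz (foldr (λ i → h (fs i)) z (allFin n))  ≡⟨ foldr-allFin-suc n h z ⟨
  foldr h z (allFin (suc n))                  ∎
  where open ≡-Reasoning

anyFin-cong : ∀ k {p q : Fin k → Bool} → (∀ i → p i ≡ q i) → anyFin k p ≡ anyFin k q
anyFin-cong k eq = foldr-allFin-cong k false λ i b → cong (_∨ b) (eq i)

allFinB-cong : ∀ k {p q : Fin k → Bool} → (∀ i → p i ≡ q i) → allFinB k p ≡ allFinB k q
allFinB-cong k eq = foldr-allFin-cong k true λ i b → cong (_∧ b) (eq i)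

countFin-cong : ∀ k {p q : Fin k → Bool} → (∀ i → p i ≡ q i) → countFin k p ≡ countFin k q
countFin-cong k eq = foldr-allFin-cong k 0 λ i c → cong (λ b → if b then suc c else c) (eq i)

allFinB-true⁻ : ∀ n (p : Fin n → Bool) → allFinB n p ≡ true → ∀ i → p i ≡ true
allFinB-true⁻ (suc n) p h fz     = proj₁ (∧-true⁻ (trans (sym (allFinB-suc n p)) h))
allFinB-true⁻ (suc n) p h (fs i) =
  allFinB-true⁻ n (λ j → p (fs j)) (proj₂ (∧-true⁻ (trans (sym (allFinB-suc n p)) h))) i

allFinB-true⁺ : ∀ n (p : Fin n → Bool) → (∀ i → p i ≡ true) → allFinB n p ≡ true
allFinB-true⁺ zero    p h = refl
allFinB-true⁺ (suc n) p h =
  trans (allFinB-suc n p) (∧-true⁺ (h fz) (allFinB-true⁺ n (λ j → p (fs j)) (λ j → h (fs j))))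

allFinB-false⁺ : ∀ n (p : Fin n → Bool) i → p i ≡ false → allFinB n p ≡ false
allFinB-false⁺ n p i q = ¬true⇒false λ h → true≢false (allFinB-true⁻ n p h i) q

allFinB-false⁻ : ∀ n (p : Fin n → Bool) → allFinB n p ≡ false → ∃ λ i → p i ≡ false
allFinB-false⁻ n p h with anyFin n (λ i → not (p i)) in eq
... | true  = let i , r = anyFin-true⁻ n _ eq in i , not-true⁻ r
... | false = ⊥-elim (true≢false (allFinB-true⁺ n p λ i →
                not-false⁻ (¬true⇒false λ r → true≢false (anyFin-true⁺ n _ i r) eq)) h)

anyFin-false⁺ : ∀ n (p : Fin n → Bool) → (∀ i → p i ≡ false) → anyFin n p ≡ false
anyFin-false⁺ n p h = ¬true⇒false λ q → let i , r = anyFin-true⁻ n p q in true≢false r (h i)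

countFin-mono : ∀ n (p q : Fin n → Bool) → (∀ i → p i ≡ true → q i ≡ true) → countFin n p ≤ countFin n q
countFin-mono zero    p q h = z≤n
countFin-mono (suc n) p q h
  rewrite countFin-suc n p | countFin-suc n q
  with p fz | q fz | h fz
... | true  | true  | _ = s≤s (countFin-mono n _ _ (λ i → h (fs i)))
... | true  | false | h₀ with () ← h₀ refl
... | false | true  | _ = m≤n⇒m≤1+n (countFin-mono n _ _ (λ i → h (fs i)))
... | false | false | _ = countFin-mono n _ _ (λ i → h (fs i))

countFin-≤ : ∀ n (p : Fin n → Bool) → countFin n p ≤ n
countFin-≤ zero    p = z≤n
countFin-≤ (suc n) p rewrite countFin-suc n p with p fz
... | true  = s≤s (countFin-≤ n _)
... | false = m≤n⇒m≤1+n (countFin-≤ n _)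

countFin-all : ∀ n (p : Fin n → Bool) → (∀ i → p i ≡ true) → countFin n p ≡ n
countFin-all zero    p h = refl
countFin-all (suc n) p h rewrite countFin-suc n p | h fz = cong suc (countFin-all n _ (λ i → h (fs i)))

countFin-none : ∀ n (p : Fin n → Bool) → (∀ i → p i ≡ false) → countFin n p ≡ 0
countFin-none zero    p h = refl
countFin-none (suc n) p h rewrite countFin-suc n p | h fz = countFin-none n _ (λ i → h (fs i))

countFin-strict : ∀ n (p q : Fin n → Bool) → (∀ i → p i ≡ true → q i ≡ true) →
  ∀ w → p w ≡ false → q w ≡ true → suc (countFin n p) ≤ countFin n q
countFin-strict (suc n) p q h fz pw qw rewrite countFin-suc n p | countFin-suc n q | pw | qw =
  s≤s (countFin-mono n _ _ (λ i → h (fs i)))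
countFin-strict (suc n) p q h (fs w) pw qw
  rewrite countFin-suc n p | countFin-suc n q
  with p fz | q fz | h fz | countFin-strict n _ _ (λ i → h (fs i)) w pw qw
... | true  | true  | _  | lt = s≤s lt
... | true  | false | h₀ | _  with () ← h₀ refl
... | false | true  | _  | lt = m≤n⇒m≤1+n lt
... | false | false | _  | lt = lt

countFin-insert : ∀ n (p q : Fin n → Bool) w → (∀ i → ¬ i ≡ w → p i ≡ q i) →
  p w ≡ false → q w ≡ true → countFin n q ≡ suc (countFin n p)
countFin-insert (suc n) p q fz h pw qw rewrite countFin-suc n p | countFin-suc n q | pw | qw =
  cong suc (countFin-cong n (λ i → sym (h (fs i) λ ())))
countFin-insert (suc n) p q (fs w) h pw qw
  rewrite countFin-suc n p | countFin-suc n q | h fz (λ ())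
  with q fz | countFin-insert n _ _ w (λ i ne → h (fs i) (λ e → ne (suc-injective e))) pw qw
... | true  | eq = cong suc eq
... | false | eq = eq

countFin-suc⇒witness : ∀ n (p : Fin n → Bool) {c} → countFin n p ≡ suc c → ∃ λ i → p i ≡ true
countFin-suc⇒witness n p eq with anyFin n p in found
... | true  = anyFin-true⁻ n p found
... | false with () ← trans (sym eq) (countFin-none n p λ i →
                        ¬true⇒false λ r → true≢false (anyFin-true⁺ n p i r) found)

countFin-positive : ∀ n (p : Fin n → Bool) i → p i ≡ true → 0 < countFin n p
countFin-positive n p i h = ≤-trans (s≤s z≤n) (countFin-strict n (λ _ → false) p (λ _ ()) i refl h)

countFin-not : ∀ k (p : Fin k → Bool) → countFin k (λ i → not (p i)) +ℕ countFin k p ≡ k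
countFin-not zero    p = refl
countFin-not (suc k) p rewrite countFin-suc k p | countFin-suc k (λ i → not (p i)) with p fz
... | true  = trans (ℕ.+-suc _ _) (cong suc (countFin-not k (λ i → p (fs i))))
... | false = cong suc (countFin-not k (λ i → p (fs i)))

-- Edge sets

module _ {m : ℕ} where

  EdgeSet-ext : {A B : EdgeSet m} → (∀ e → lookup A e ≡ lookup B e) → A ≡ B
  EdgeSet-ext {A} {B} h = trans (sym (tabulate∘lookup A)) (trans (tabulate-cong h) (tabulate∘lookup B))

  addEdge : EdgeSet m → Fin m → EdgeSet m
  addEdge A f = A [ f ]≔ true

  _⊆_ : EdgeSet m → EdgeSet m → Set
  A ⊆ B = ∀ e → lookup A e ≡ true → lookup B e ≡ true

  Disjoint : EdgeSet m → EdgeSet m → Set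
  Disjoint A B = ∀ e → lookup A e ≡ true → lookup B e ≡ false

  lookup-∪ : ∀ (A B : EdgeSet m) e → lookup (A ∪ B) e ≡ (lookup A e ∨ lookup B e)
  lookup-∪ A B e = lookup-zipWith _∨_ e A B

  lookup-∅ : ∀ e → lookup (∅ {m}) e ≡ false
  lookup-∅ e = lookup-replicate e false

  lookup-addEdge-self : ∀ (A : EdgeSet m) f → lookup (addEdge A f) f ≡ true
  lookup-addEdge-self A f = lookup∘update f A true

  lookup-addEdge-other : ∀ (A : EdgeSet m) {f e} → ¬ e ≡ f → lookup (addEdge A f) e ≡ lookup A e
  lookup-addEdge-other A ne = lookup∘update′ ne A true

  lookup-removeEdge-self : ∀ (A : EdgeSet m) f → lookup (removeEdge A f) f ≡ false
  lookup-removeEdge-self A f = lookup∘update f A false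

  lookup-removeEdge-other : ∀ (A : EdgeSet m) {f e} → ¬ e ≡ f → lookup (removeEdge A f) e ≡ lookup A e
  lookup-removeEdge-other A ne = lookup∘update′ ne A false

  lookup-addEdge : ∀ (A : EdgeSet m) f e → lookup (addEdge A f) e ≡ (e == f) ∨ lookup A e
  lookup-addEdge A f e with e ≟ f
  ... | yes refl = lookup-addEdge-self A e
  ... | no ne    = lookup-addEdge-other A ne

  lookup-addEdge-true⁻ : ∀ (A : EdgeSet m) {f e} → lookup (addEdge A f) e ≡ true → e ≡ f ⊎ lookup A e ≡ true
  lookup-addEdge-true⁻ A {f} {e} h with e ≟ f
  ... | yes eq = inj₁ eq
  ... | no ne  = inj₂ (trans (sym (lookup-addEdge-other A ne)) h)

  ⊆-trans : ∀ {A B C} → A ⊆ B → B ⊆ C → A ⊆ C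
  ⊆-trans s t e h = t e (s e h)

  ⊆-addEdge : ∀ (A : EdgeSet m) f → A ⊆ addEdge A f
  ⊆-addEdge A f e h with e ≟ f
  ... | yes refl = lookup-addEdge-self A f
  ... | no ne    = trans (lookup-addEdge-other A ne) h

  removeEdge-⊆ : ∀ (A : EdgeSet m) f → removeEdge A f ⊆ A
  removeEdge-⊆ A f e h with e ≟ f
  ... | yes refl = ⊥-elim (true≢false h (lookup-removeEdge-self A f))
  ... | no ne    = trans (sym (lookup-removeEdge-other A ne)) h

  ⊆-removeEdge : ∀ {A B : EdgeSet m} {f} → A ⊆ B → lookup A f ≡ false → A ⊆ removeEdge B f
  ⊆-removeEdge {A} {B} {f} s af e h with e ≟ f
  ... | yes refl = ⊥-elim (true≢false h af)
  ... | no ne    = trans (lookup-removeEdge-other B ne) (s e h)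

  removeEdge-mono : ∀ {A B : EdgeSet m} f → A ⊆ B → removeEdge A f ⊆ removeEdge B f
  removeEdge-mono {A} {B} f s e h with e ≟ f
  ... | yes refl = ⊥-elim (true≢false h (lookup-removeEdge-self A f))
  ... | no ne    = trans (lookup-removeEdge-other B ne) (s e (trans (sym (lookup-removeEdge-other A ne)) h))

  ⊆-∪ˡ : ∀ (A B : EdgeSet m) → A ⊆ (A ∪ B)
  ⊆-∪ˡ A B e h = trans (lookup-∪ A B e) (∨-trueˡ _ h)

  ⊆-∪ʳ : ∀ (A B : EdgeSet m) → B ⊆ (A ∪ B)
  ⊆-∪ʳ A B e h = trans (lookup-∪ A B e) (∨-trueʳ _ h)

  ∪-monoˡ : ∀ {A A'} (C : EdgeSet m) → A ⊆ A' → (A ∪ C) ⊆ (A' ∪ C)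
  ∪-monoˡ {A} {A'} C s e h with ∨-true⁻ (trans (sym (lookup-∪ A C e)) h)
  ... | inj₁ a = ⊆-∪ˡ A' C e (s e a)
  ... | inj₂ c = ⊆-∪ʳ A' C e c

  ∪-monoʳ : ∀ (A : EdgeSet m) {C C'} → C ⊆ C' → (A ∪ C) ⊆ (A ∪ C')
  ∪-monoʳ A {C} {C'} s e h with ∨-true⁻ (trans (sym (lookup-∪ A C e)) h)
  ... | inj₁ a = ⊆-∪ˡ A C' e a
  ... | inj₂ c = ⊆-∪ʳ A C' e (s e c)

  ∪-∅ : ∀ (A : EdgeSet m) → A ∪ ∅ ≡ A
  ∪-∅ A = EdgeSet-ext λ e →
    trans (lookup-∪ A ∅ e) (trans (cong (lookup A e ∨_) (lookup-∅ e)) (∨-identityʳ (lookup A e)))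

  addEdge-∪ : ∀ (A C : EdgeSet m) f → addEdge A f ∪ C ≡ addEdge (A ∪ C) f
  addEdge-∪ A C f = EdgeSet-ext λ e → begin
    lookup (addEdge A f ∪ C) e          ≡⟨ lookup-∪ (addEdge A f) C e ⟩
    lookup (addEdge A f) e ∨ lookup C e ≡⟨ cong (_∨ lookup C e) (lookup-addEdge A f e) ⟩
    ((e == f) ∨ lookup A e) ∨ lookup C e ≡⟨ ∨-assoc (e == f) _ _ ⟩
    (e == f) ∨ (lookup A e ∨ lookup C e) ≡⟨ cong ((e == f) ∨_) (lookup-∪ A C e) ⟨
    (e == f) ∨ lookup (A ∪ C) e         ≡⟨ lookup-addEdge (A ∪ C) f e ⟨
    lookup (addEdge (A ∪ C) f) e        ∎
    where open ≡-Reasoning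

  ∪-addEdge : ∀ (A C : EdgeSet m) f → A ∪ addEdge C f ≡ addEdge (A ∪ C) f
  ∪-addEdge A C f = EdgeSet-ext λ e → begin
    lookup (A ∪ addEdge C f) e           ≡⟨ lookup-∪ A (addEdge C f) e ⟩
    lookup A e ∨ lookup (addEdge C f) e  ≡⟨ cong (lookup A e ∨_) (lookup-addEdge C f e) ⟩
    lookup A e ∨ ((e == f) ∨ lookup C e) ≡⟨ ∨-assoc (lookup A e) _ _ ⟨
    (lookup A e ∨ (e == f)) ∨ lookup C e ≡⟨ cong (_∨ lookup C e) (∨-comm (lookup A e) (e == f)) ⟩
    ((e == f) ∨ lookup A e) ∨ lookup C e ≡⟨ ∨-assoc (e == f) _ _ ⟩
    (e == f) ∨ (lookup A e ∨ lookup C e) ≡⟨ cong ((e == f) ∨_) (lookup-∪ A C e) ⟨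
    (e == f) ∨ lookup (A ∪ C) e          ≡⟨ lookup-addEdge (A ∪ C) f e ⟨
    lookup (addEdge (A ∪ C) f) e         ∎
    where open ≡-Reasoning

  addEdge-∪-swap : ∀ (A C : EdgeSet m) f → addEdge A f ∪ C ≡ A ∪ addEdge C f
  addEdge-∪-swap A C f = trans (addEdge-∪ A C f) (sym (∪-addEdge A C f))

  removeEdge-addEdge : ∀ (A : EdgeSet m) f → lookup A f ≡ false → removeEdge (addEdge A f) f ≡ A
  removeEdge-addEdge A f af = EdgeSet-ext λ e → lemma e
    where
    lemma : ∀ e → lookup (removeEdge (addEdge A f) f) e ≡ lookup A e
    lemma e with e ≟ f
    ... | yes refl = trans (lookup-removeEdge-self (addEdge A e) e) (sym af)
    ... | no ne    = trans (lookup-removeEdge-other (addEdge A f) ne) (lookup-addEdge-other A ne)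

  removeEdge-addEdge-⊆ : ∀ (A : EdgeSet m) f → removeEdge (addEdge A f) f ⊆ A
  removeEdge-addEdge-⊆ A f e h with e ≟ f
  ... | yes refl = ⊥-elim (true≢false h (lookup-removeEdge-self (addEdge A e) e))
  ... | no ne = trans (sym (lookup-addEdge-other A ne)) (trans (sym (lookup-removeEdge-other (addEdge A f) ne)) h)

  addEdge-removeEdge : ∀ (A : EdgeSet m) f → lookup A f ≡ true → addEdge (removeEdge A f) f ≡ A
  addEdge-removeEdge A f af = EdgeSet-ext λ e → lemma e
    where
    lemma : ∀ e → lookup (addEdge (removeEdge A f) f) e ≡ lookup A e
    lemma e with e ≟ f
    ... | yes refl = trans (lookup-addEdge-self (removeEdge A e) e) (sym af)
    ... | no ne    = trans (lookup-addEdge-other (removeEdge A f) ne) (lookup-removeEdge-other A ne)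

  empty-∪ : ∀ (A C : EdgeSet m) → (∀ e → lookup A e ≡ false) → A ∪ C ≡ C
  empty-∪ A C h = EdgeSet-ext λ e → trans (lookup-∪ A C e) (cong (_∨ lookup C e) (h e))

  ∅-∪ : ∀ (C : EdgeSet m) → ∅ ∪ C ≡ C
  ∅-∪ C = empty-∪ ∅ C lookup-∅

  removeEdge-addEdge-comm : ∀ (A : EdgeSet m) {f i} → ¬ i ≡ f →
    removeEdge (addEdge A f) i ≡ addEdge (removeEdge A i) f
  removeEdge-addEdge-comm A {f} {i} i≢f = EdgeSet-ext λ e → lemma e
    where
    lemma : ∀ e → lookup (removeEdge (addEdge A f) i) e ≡ lookup (addEdge (removeEdge A i) f) e
    lemma e with e ≟ i | e ≟ f
    ... | yes refl | yes refl = ⊥-elim (i≢f refl)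
    ... | yes refl | no ne = trans (lookup-removeEdge-self (addEdge A f) e)
                               (sym (trans (lookup-addEdge-other (removeEdge A e) ne) (lookup-removeEdge-self A e)))
    ... | no ne | yes refl = trans (lookup-removeEdge-other (addEdge A e) ne)
                               (trans (lookup-addEdge-self A e) (sym (lookup-addEdge-self (removeEdge A i) e)))
    ... | no ne | no ne' = trans (lookup-removeEdge-other (addEdge A f) ne) (trans (lookup-addEdge-other A ne')
                             (sym (trans (lookup-addEdge-other (removeEdge A i) ne') (lookup-removeEdge-other A ne))))

  removeEdge-∪ : ∀ (A C : EdgeSet m) {f} → lookup C f ≡ false → removeEdge A f ∪ C ≡ removeEdge (A ∪ C) f
  removeEdge-∪ A C {f} cf = EdgeSet-ext λ e → lemma e
    where
    lemma : ∀ e → lookup (removeEdge A f ∪ C) e ≡ lookup (removeEdge (A ∪ C) f) e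
    lemma e with e ≟ f
    ... | yes refl = begin
      lookup (removeEdge A e ∪ C) e          ≡⟨ lookup-∪ (removeEdge A e) C e ⟩
      lookup (removeEdge A e) e ∨ lookup C e ≡⟨ cong₂ _∨_ (lookup-removeEdge-self A e) cf ⟩
      false                                  ≡⟨ lookup-removeEdge-self (A ∪ C) e ⟨
      lookup (removeEdge (A ∪ C) e) e        ∎
      where open ≡-Reasoning
    ... | no ne = begin
      lookup (removeEdge A f ∪ C) e          ≡⟨ lookup-∪ (removeEdge A f) C e ⟩
      lookup (removeEdge A f) e ∨ lookup C e ≡⟨ cong (_∨ lookup C e) (lookup-removeEdge-other A ne) ⟩
      lookup A e ∨ lookup C e                ≡⟨ lookup-∪ A C e ⟨
      lookup (A ∪ C) e                       ≡⟨ lookup-removeEdge-other (A ∪ C) ne ⟨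
      lookup (removeEdge (A ∪ C) f) e        ∎
      where open ≡-Reasoning

  size-removeEdge : ∀ (A : EdgeSet m) f → lookup A f ≡ true → size A ≡ suc (size (removeEdge A f))
  size-removeEdge A f h =
    countFin-insert m _ _ f (λ e ne → lookup-removeEdge-other A ne) (lookup-removeEdge-self A f) h

  size-addEdge : ∀ (A : EdgeSet m) f → lookup A f ≡ false → size (addEdge A f) ≡ suc (size A)
  size-addEdge A f h =
    countFin-insert m _ _ f (λ e ne → sym (lookup-addEdge-other A ne)) h (lookup-addEdge-self A f)

  size-∅ : size (∅ {m}) ≡ 0
  size-∅ = countFin-none m _ lookup-∅

  size-induction : (P : EdgeSet m → Set) → (∀ A → (∀ e → lookup A e ≡ false) → P A) →
    (∀ A f → lookup A f ≡ true → P (removeEdge A f) → P A) → ∀ A → P A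
  size-induction P base step A = go (size A) A refl
    where
    go : ∀ s A → size A ≡ s → P A
    go zero A eq = base A λ e → ¬true⇒false λ h → <-irrefl (sym eq) (countFin-positive m (lookup A) e h)
    go (suc s) A eq with countFin-suc⇒witness m (lookup A) eq
    ... | f , h = step A f h (go s (removeEdge A f) (ℕ.suc-injective (trans (sym (size-removeEdge A f h)) eq)))

-- Finite sums of rationals

private variable X Y : Set

∑ : List X → (X → ℚ) → ℚ
∑ L F = sumℚ (map F L)

∑-cong : ∀ (L : List X) {F F' : X → ℚ} → (∀ x → F x ≡ F' x) → ∑ L F ≡ ∑ L F'
∑-cong []      h = refl
∑-cong (x ∷ L) h = cong₂ _+_ (h x) (∑-cong L h)

∑-++ : ∀ (L L' : List X) F → ∑ (L ++ L') F ≡ ∑ L F + ∑ L' F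
∑-++ []      L' F = sym (+-identityˡ _)
∑-++ (x ∷ L) L' F = trans (cong (F x +_) (∑-++ L L' F)) (sym (+-assoc (F x) _ _))

∑-map : ∀ (L : List Y) (g : Y → X) F → ∑ (map g L) F ≡ ∑ L (λ y → F (g y))
∑-map []      g F = refl
∑-map (y ∷ L) g F = cong (F (g y) +_) (∑-map L g F)

∑-concatMap : ∀ (L : List Y) (g : Y → List X) F → ∑ (concatMap g L) F ≡ ∑ L (λ y → ∑ (g y) F)
∑-concatMap []      g F = refl
∑-concatMap (y ∷ L) g F = trans (∑-++ (g y) (concat (map g L)) F) (cong (∑ (g y) F +_) (∑-concatMap L g F))

∑-zero : ∀ (L : List X) → ∑ L (λ _ → 0ℚ) ≡ 0ℚ
∑-zero []      = refl
∑-zero (x ∷ L) = trans (+-identityˡ _) (∑-zero L)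

∑-+ : ∀ (L : List X) F F' → ∑ L (λ x → F x + F' x) ≡ ∑ L F + ∑ L F'
∑-+ []      F F' = sym (+-identityˡ 0ℚ)
∑-+ (x ∷ L) F F' = trans (cong ((F x + F' x) +_) (∑-+ L F F'))
  (solve 4 (λ a b c d → (a :+ b) :+ (c :+ d) := (a :+ c) :+ (b :+ d)) refl (F x) (F' x) (∑ L F) (∑ L F'))

∑-*ˡ : ∀ (L : List X) c F → ∑ L (λ x → c * F x) ≡ c * ∑ L F
∑-*ˡ []      c F = sym (*-zeroʳ c)
∑-*ˡ (x ∷ L) c F = trans (cong (c * F x +_) (∑-*ˡ L c F)) (sym (*-distribˡ-+ c (F x) (∑ L F)))

∑-swap : ∀ (L : List X) (M : List Y) (F : X → Y → ℚ) →
  ∑ L (λ x → ∑ M (F x)) ≡ ∑ M (λ y → ∑ L (λ x → F x y))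
∑-swap []      M F = sym (∑-zero M)
∑-swap (x ∷ L) M F = trans (cong (∑ M (F x) +_) (∑-swap L M F)) (sym (∑-+ M (F x) _))

∑-filter : ∀ (P : X → Bool) (L : List X) F →
  ∑ (filter (λ x → P x ≟B true) L) F ≡ ∑ L (λ x → if P x then F x else 0ℚ)
∑-filter P []      F = refl
∑-filter P (x ∷ L) F with P x
... | true  = cong (F x +_) (∑-filter P L F)
... | false = trans (∑-filter P L F) (sym (+-identityˡ _))

∑-allEdgeSets-suc : ∀ k (F : EdgeSet (suc k) → ℚ) →
  ∑ (allEdgeSets (suc k)) F ≡ ∑ (allEdgeSets k) (λ A → F (true ∷ A)) + ∑ (allEdgeSets k) (λ A → F (false ∷ A))
∑-allEdgeSets-suc k F = begin
  ∑ (map (true ∷_) V ++ (map (false ∷_) V ++ [])) F      ≡⟨ ∑-++ (map (true ∷_) V) _ F ⟩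
  ∑ (map (true ∷_) V) F + ∑ (map (false ∷_) V ++ []) F  ≡⟨ cong (∑ (map (true ∷_) V) F +_)
                                                             (trans (∑-++ (map (false ∷_) V) [] F) (+-identityʳ _)) ⟩
  ∑ (map (true ∷_) V) F + ∑ (map (false ∷_) V) F        ≡⟨ cong₂ _+_ (∑-map V (true ∷_) F)
                                                                      (∑-map V (false ∷_) F) ⟩
  ∑ V (λ A → F (true ∷ A)) + ∑ V (λ A → F (false ∷ A))  ∎
  where
  open ≡-Reasoning
  V = allEdgeSets k

∑-allEdgeSets-pair : ∀ k (e : Fin k) (F : EdgeSet k → ℚ) →
  ∑ (allEdgeSets k) F ≡ ∑ (allEdgeSets k) (λ A → if lookup A e then 0ℚ else F A + F (addEdge A e))
∑-allEdgeSets-pair (suc k) fz F = begin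
  ∑ (allEdgeSets (suc k)) F
    ≡⟨ ∑-allEdgeSets-suc k F ⟩
  ∑ V (λ A → F (true ∷ A)) + ∑ V (λ A → F (false ∷ A))
    ≡⟨ solve 2 (λ a b → a :+ b := con 0ℚ :+ (b :+ a)) refl
               (∑ V (λ A → F (true ∷ A))) (∑ V (λ A → F (false ∷ A))) ⟩
  0ℚ + (∑ V (λ A → F (false ∷ A)) + ∑ V (λ A → F (true ∷ A)))
    ≡⟨ cong₂ _+_ (∑-zero V) (∑-+ V (λ A → F (false ∷ A)) (λ A → F (true ∷ A))) ⟨
  ∑ V (λ _ → 0ℚ) + ∑ V (λ A → F (false ∷ A) + F (true ∷ A))
    ≡⟨ ∑-allEdgeSets-suc k _ ⟨
  ∑ (allEdgeSets (suc k)) (λ A → if lookup A fz then 0ℚ else F A + F (addEdge A fz))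
    ∎
  where
  open ≡-Reasoning
  V = allEdgeSets k
∑-allEdgeSets-pair (suc k) (fs e) F =
  trans (∑-allEdgeSets-suc k F)
    (trans (cong₂ _+_ (∑-allEdgeSets-pair k e (λ A → F (true ∷ A)))
                      (∑-allEdgeSets-pair k e (λ A → F (false ∷ A))))
      (sym (∑-allEdgeSets-suc k _)))

∑-allEdgeSets-∅ : ∀ k (F : EdgeSet k → ℚ) →
  ∑ (allEdgeSets k) (λ A → if allFinB k (λ e → not (lookup A e)) then F A else 0ℚ) ≡ F (replicate k false)
∑-allEdgeSets-∅ zero    F = +-identityʳ _
∑-allEdgeSets-∅ (suc k) F = begin
  ∑ (allEdgeSets (suc k)) (λ A → if allFinB (suc k) (λ e → not (lookup A e)) then F A else 0ℚ)
    ≡⟨ ∑-allEdgeSets-suc k _ ⟩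
  ∑ V (λ A → if allFinB (suc k) (λ e → not (lookup (true ∷ A) e)) then F (true ∷ A) else 0ℚ)
    + ∑ V (λ A → if allFinB (suc k) (λ e → not (lookup (false ∷ A) e)) then F (false ∷ A) else 0ℚ)
    ≡⟨ cong₂ _+_ (trans (∑-cong V λ A → cong (if_then F (true ∷ A) else 0ℚ)
                                              (allFinB-suc k (λ e → not (lookup (true ∷ A) e))))
                        (∑-zero V))
                 (trans (∑-cong V λ A → cong (if_then F (false ∷ A) else 0ℚ)
                                              (allFinB-suc k (λ e → not (lookup (false ∷ A) e))))
                        (∑-allEdgeSets-∅ k (λ A → F (false ∷ A)))) ⟩
  0ℚ + F (replicate (suc k) false)
    ≡⟨ +-identityˡ _ ⟩
  F (replicate (suc k) false)
    ∎
  where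
  open ≡-Reasoning
  V = allEdgeSets k

∑-allFin-suc : ∀ k (F : Fin (suc k) → ℚ) → ∑ (allFin (suc k)) F ≡ F fz + ∑ (allFin k) (λ i → F (fs i))
∑-allFin-suc k F = cong (F fz +_) (trans (cong (λ L → ∑ L F) (sym (map-tabulate id fs))) (∑-map (allFin k) fs F))

∑-filter-cong : ∀ (P : X → Bool) (L : List X) {F F' : X → ℚ} → (∀ x → P x ≡ true → F x ≡ F' x) →
  ∑ (filter (λ x → P x ≟B true) L) F ≡ ∑ (filter (λ x → P x ≟B true) L) F'
∑-filter-cong P []      h = refl
∑-filter-cong P (x ∷ L) h with P x in px
... | true  = cong₂ _+_ (h x px) (∑-filter-cong P L h)
... | false = ∑-filter-cong P L h

module _ {m : ℕ} where

  _⊆ᵇ_ : EdgeSet m → EdgeSet m → Bool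
  A ⊆ᵇ S = allFinB m (λ e → lookup A e ⇒ᵇ lookup S e)

  ⊆ᵇ-true⁻ : ∀ A S → (A ⊆ᵇ S) ≡ true → A ⊆ S
  ⊆ᵇ-true⁻ A S h e ae = ⇒ᵇ-true⁻ (allFinB-true⁻ m _ h e) ae

  ⊆ᵇ-true⁺ : ∀ A S → A ⊆ S → (A ⊆ᵇ S) ≡ true
  ⊆ᵇ-true⁺ A S s = allFinB-true⁺ m _ λ e → ⇒ᵇ-true⁺ (lookup A e) (s e)

  ∑⊆ : EdgeSet m → (EdgeSet m → ℚ) → ℚ
  ∑⊆ S F = ∑ (allEdgeSets m) (λ A → if A ⊆ᵇ S then F A else 0ℚ)

  ∑⊆-cong : ∀ S {F F'} → (∀ A → (A ⊆ᵇ S) ≡ true → F A ≡ F' A) → ∑⊆ S F ≡ ∑⊆ S F'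
  ∑⊆-cong S {F} {F'} h = ∑-cong (allEdgeSets m) λ A → guarded A (A ⊆ᵇ S) refl
    where
    guarded : ∀ A b → (A ⊆ᵇ S) ≡ b → (if b then F A else 0ℚ) ≡ (if b then F' A else 0ℚ)
    guarded A true  e = h A e
    guarded A false e = refl

  ∑⊆-*ˡ : ∀ S c F → ∑⊆ S (λ A → c * F A) ≡ c * ∑⊆ S F
  ∑⊆-*ˡ S c F = trans (∑-cong (allEdgeSets m) λ A → guarded (A ⊆ᵇ S) (F A)) (∑-*ˡ (allEdgeSets m) c _)
    where
    guarded : ∀ b v → (if b then c * v else 0ℚ) ≡ c * (if b then v else 0ℚ)
    guarded true  v = refl
    guarded false v = sym (*-zeroʳ c)

  ∑⊆-zero : ∀ S → ∑⊆ S (λ _ → 0ℚ) ≡ 0ℚ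
  ∑⊆-zero S = trans (∑-cong (allEdgeSets m) λ A → guarded (A ⊆ᵇ S)) (∑-zero (allEdgeSets m))
    where
    guarded : ∀ b → (if b then 0ℚ else 0ℚ) ≡ 0ℚ
    guarded true  = refl
    guarded false = refl

  ⊆ᵇ-addEdge : ∀ A S {e} → lookup A e ≡ false → (A ⊆ᵇ addEdge S e) ≡ (A ⊆ᵇ S)
  ⊆ᵇ-addEdge A S {e₀} ae₀ = allFinB-cong m λ e → lemma e
    where
    lemma : ∀ e → (lookup A e ⇒ᵇ lookup (addEdge S e₀) e) ≡ (lookup A e ⇒ᵇ lookup S e)
    lemma e with e ≟ e₀
    ... | yes refl rewrite ae₀ = refl
    ... | no ne = cong (lookup A e ⇒ᵇ_) (lookup-addEdge-other S ne)

  addEdge-⊆ᵇ-addEdge : ∀ A S {e} → lookup A e ≡ false → lookup S e ≡ false →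
    (addEdge A e ⊆ᵇ addEdge S e) ≡ (A ⊆ᵇ S)
  addEdge-⊆ᵇ-addEdge A S {e₀} ae₀ se₀ = allFinB-cong m λ e → lemma e
    where
    lemma : ∀ e → (lookup (addEdge A e₀) e ⇒ᵇ lookup (addEdge S e₀) e) ≡ (lookup A e ⇒ᵇ lookup S e)
    lemma e with e ≟ e₀
    ... | yes refl rewrite lookup-addEdge-self S e | se₀ | ae₀ = ⇒ᵇ-zeroʳ _
    ... | no ne = cong₂ _⇒ᵇ_ (lookup-addEdge-other A ne) (lookup-addEdge-other S ne)

  addEdge-⊆ᵇ : ∀ A S {e} → lookup S e ≡ false → (addEdge A e ⊆ᵇ S) ≡ false
  addEdge-⊆ᵇ A S {e₀} se₀ = allFinB-false⁺ m _ e₀ (cong₂ _⇒ᵇ_ (lookup-addEdge-self A e₀) se₀)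

  ∑⊆-addEdge : ∀ S e₀ → lookup S e₀ ≡ false → ∀ F →
    ∑⊆ (addEdge S e₀) F ≡ ∑⊆ S F + ∑⊆ S (λ A → F (addEdge A e₀))
  ∑⊆-addEdge S e₀ se₀ F =
    trans (∑-allEdgeSets-pair m e₀ _)
    (trans (∑-cong (allEdgeSets m) split)
    (trans (∑-+ (allEdgeSets m) _ _)
    (cong₂ _+_ (sym (trans (∑-allEdgeSets-pair m e₀ _) (∑-cong (allEdgeSets m) dropˡ)))
               (sym (trans (∑-allEdgeSets-pair m e₀ _) (∑-cong (allEdgeSets m) dropʳ))))))
    where
    S⁺ = addEdge S e₀
    guard : Bool → ℚ → ℚ
    guard b v = if b then v else 0ℚ
    split : ∀ A → (if lookup A e₀ then 0ℚ
                   else (guard (A ⊆ᵇ S⁺) (F A) + guard (addEdge A e₀ ⊆ᵇ S⁺) (F (addEdge A e₀))))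
                ≡ (if lookup A e₀ then 0ℚ else guard (A ⊆ᵇ S) (F A))
                  + (if lookup A e₀ then 0ℚ else guard (A ⊆ᵇ S) (F (addEdge A e₀)))
    split A with lookup A e₀ in ae₀
    ... | true  = refl
    ... | false rewrite ⊆ᵇ-addEdge A S ae₀ | addEdge-⊆ᵇ-addEdge A S ae₀ se₀ = refl
    dropˡ : ∀ A → (if lookup A e₀ then 0ℚ
                   else (guard (A ⊆ᵇ S) (F A) + guard (addEdge A e₀ ⊆ᵇ S) (F (addEdge A e₀))))
                ≡ (if lookup A e₀ then 0ℚ else guard (A ⊆ᵇ S) (F A))
    dropˡ A with lookup A e₀
    ... | true  = refl
    ... | false rewrite addEdge-⊆ᵇ A S se₀ = +-identityʳ _
    dropʳ : ∀ A → (if lookup A e₀ then 0ℚ else (guard (A ⊆ᵇ S) (F (addEdge A e₀))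
                                              + guard (addEdge A e₀ ⊆ᵇ S) (F (addEdge (addEdge A e₀) e₀))))
                ≡ (if lookup A e₀ then 0ℚ else guard (A ⊆ᵇ S) (F (addEdge A e₀)))
    dropʳ A with lookup A e₀
    ... | true  = refl
    ... | false rewrite addEdge-⊆ᵇ A S se₀ = +-identityʳ _

  ∑⊆-∅ : ∀ F → ∑⊆ ∅ F ≡ F ∅
  ∑⊆-∅ F = trans (∑-cong (allEdgeSets m) λ A → cong (if_then F A else 0ℚ) (⊆ᵇ-∅ A)) (∑-allEdgeSets-∅ m F)
    where
    ⊆ᵇ-∅ : ∀ A → (A ⊆ᵇ ∅) ≡ allFinB m (λ e → not (lookup A e))
    ⊆ᵇ-∅ A = allFinB-cong m λ e → trans (cong (lookup A e ⇒ᵇ_) (lookup-∅ e)) (⇒ᵇ-false (lookup A e))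
      where
      ⇒ᵇ-false : ∀ p → (p ⇒ᵇ false) ≡ not p
      ⇒ᵇ-false true  = refl
      ⇒ᵇ-false false = refl

·-as-* : ∀ k c → k · c ≡ (k · 1ℚ) * c
·-as-* k c = sym (trans (×-assoc-* k 1ℚ c) (cong (k ·_) (*-identityˡ c)))

∑-· : ∀ (L : List X) k F → ∑ L (λ z → k · F z) ≡ k · ∑ L F
∑-· L k F = trans (∑-cong L λ z → ·-as-* k (F z)) (trans (∑-*ˡ L (k · 1ℚ) F) (sym (·-as-* k (∑ L F))))

·-zeroʳ : ∀ k → k · 0ℚ ≡ 0ℚ
·-zeroʳ zero    = refl
·-zeroʳ (suc k) = trans (+-identityˡ _) (·-zeroʳ k)

∑-count : ∀ k (p : Fin k → Bool) c → ∑ (allFin k) (λ i → if p i then c else 0ℚ) ≡ countFin k p · c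
∑-count zero    p c = refl
∑-count (suc k) p c rewrite ∑-allFin-suc k (λ i → if p i then c else 0ℚ) | ∑-count k (λ i → p (fs i)) c
                          | countFin-suc k p with p fz
... | true  = refl
... | false = +-identityˡ _

-- Counting permutations

_∈ᵇ_ : ∀ {m k} → Fin m → Vec (Fin m) k → Bool
x ∈ᵇ []      = false
x ∈ᵇ (y ∷ v) = (x == y) ∨ (x ∈ᵇ v)

injective? : ∀ {m k} → Vec (Fin m) k → Bool
injective? []      = true
injective? (x ∷ v) = not (x ∈ᵇ v) ∧ injective? v

Injective : ∀ {m k} → Vec (Fin m) k → Set
Injective {k = k} v = ∀ (i j : Fin k) → lookup v i ≡ lookup v j → i ≡ j

∈ᵇ-true⁻ : ∀ {m k} (x : Fin m) (v : Vec (Fin m) k) → x ∈ᵇ v ≡ true → ∃ λ i → lookup v i ≡ x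
∈ᵇ-true⁻ x (y ∷ v) h with ∨-true⁻ {x == y} h
... | inj₁ q = fz , sym (==-true⁻ q)
... | inj₂ q with ∈ᵇ-true⁻ x v q
... | i , r = fs i , r

∈ᵇ-true⁺ : ∀ {m k} (v : Vec (Fin m) k) i → lookup v i ∈ᵇ v ≡ true
∈ᵇ-true⁺ (y ∷ v) fz     = ∨-trueˡ _ (==-refl y)
∈ᵇ-true⁺ (y ∷ v) (fs i) = ∨-trueʳ _ (∈ᵇ-true⁺ v i)

injective?-true⁻ : ∀ {m k} (v : Vec (Fin m) k) → injective? v ≡ true → Injective v
injective?-true⁻ (x ∷ v) h fz     fz     e = refl
injective?-true⁻ (x ∷ v) h fz     (fs j) e =
  ⊥-elim (true≢false (subst (λ z → z ∈ᵇ v ≡ true) (sym e) (∈ᵇ-true⁺ v j))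
                     (not-true⁻ (proj₁ (∧-true⁻ h))))
injective?-true⁻ (x ∷ v) h (fs i) fz     e =
  ⊥-elim (true≢false (subst (λ z → z ∈ᵇ v ≡ true) e (∈ᵇ-true⁺ v i)) (not-true⁻ (proj₁ (∧-true⁻ h))))
injective?-true⁻ (x ∷ v) h (fs i) (fs j) e =
  cong fs (injective?-true⁻ v (proj₂ (∧-true⁻ {not (x ∈ᵇ v)} h)) i j e)

injective?-true⁺ : ∀ {m k} (v : Vec (Fin m) k) → Injective v → injective? v ≡ true
injective?-true⁺ []      inj = refl
injective?-true⁺ (x ∷ v) inj = ∧-true⁺
  (cong not (¬true⇒false λ h → let i , r = ∈ᵇ-true⁻ x v h in fz≢fs (inj fz (fs i) (sym r))))
  (injective?-true⁺ v λ i j e → suc-injective (inj (fs i) (fs j) e))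
  where
  fz≢fs : ∀ {k} {i : Fin k} → ¬ fz ≡ fs i
  fz≢fs ()

isPerm≡injective? : ∀ {m} (π : Vec (Fin m) m) → isPerm π ≡ injective? π
isPerm≡injective? {m} π = Bool-ext
  (λ h → injective?-true⁺ π λ i j e →
    ==-true⁻ (⇒ᵇ-true⁻ (allFinB-true⁻ m _ (allFinB-true⁻ m _ h i) j)
                       (subst (λ z → (lookup π i == z) ≡ true) e (==-refl _))))
  (λ h → allFinB-true⁺ m _ λ i → allFinB-true⁺ m _ λ j → ⇒ᵇ-true⁺ _ λ e →
    subst (λ z → (i == z) ≡ true) (injective?-true⁻ π h i j (==-true⁻ e)) (==-refl i))

countFin-∈ᵇ : ∀ {m k} (v : Vec (Fin m) k) → injective? v ≡ true → countFin m (_∈ᵇ v) ≡ k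
countFin-∈ᵇ {m} []      h = countFin-none m _ (λ _ → refl)
countFin-∈ᵇ {m} (y ∷ v) h =
  trans (countFin-insert m (_∈ᵇ v) (_∈ᵇ (y ∷ v)) y (λ x ne → cong (_∨ (x ∈ᵇ v)) (sym (==-false ne)))
          (not-true⁻ (proj₁ (∧-true⁻ h))) (∨-trueˡ _ (==-refl y)))
        (cong suc (countFin-∈ᵇ v (proj₂ (∧-true⁻ {not (y ∈ᵇ v)} h))))

countFin-∉ᵇ : ∀ {m k} (v : Vec (Fin m) k) → injective? v ≡ true → countFin m (λ x → not (x ∈ᵇ v)) ≡ m ∸ k
countFin-∉ᵇ {m} {k} v h = trans (sym (m+n∸n≡m (countFin m (λ x → not (x ∈ᵇ v))) k))
  (cong (_∸ k) (trans (cong (countFin m (λ x → not (x ∈ᵇ v)) +ℕ_) (sym (countFin-∈ᵇ v h)))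
                      (countFin-not m (_∈ᵇ v))))

∑-injective : ∀ m k c → ∑ (allVecs (allFin m) k) (λ v → if injective? v then c else 0ℚ) ≡ (m P′ k) · c
∑-injective m zero    c = refl
∑-injective m (suc k) c = begin
  ∑ (concatMap (λ x → map (x ∷_) V) (allFin m)) (λ v → if injective? v then c else 0ℚ)
    ≡⟨ ∑-concatMap (allFin m) (λ x → map (x ∷_) V) _ ⟩
  ∑ (allFin m) (λ x → ∑ (map (x ∷_) V) (λ v → if injective? v then c else 0ℚ))
    ≡⟨ ∑-cong (allFin m) (λ x → ∑-map V (x ∷_) _) ⟩
  ∑ (allFin m) (λ x → ∑ V (λ v → if injective? (x ∷ v) then c else 0ℚ))
    ≡⟨ ∑-swap (allFin m) V _ ⟩
  ∑ V (λ v → ∑ (allFin m) (λ x → if injective? (x ∷ v) then c else 0ℚ))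
    ≡⟨ ∑-cong V extend ⟩
  ∑ V (λ v → (m ∸ k) · (if injective? v then c else 0ℚ))
    ≡⟨ ∑-· V (m ∸ k) _ ⟩
  (m ∸ k) · ∑ V (λ v → if injective? v then c else 0ℚ)
    ≡⟨ cong ((m ∸ k) ·_) (∑-injective m k c) ⟩
  (m ∸ k) · ((m P′ k) · c)
    ≡⟨ ×-assocˡ c (m ∸ k) (m P′ k) ⟩
  (m P′ suc k) · c
    ∎
  where
  open ≡-Reasoning
  V = allVecs (allFin m) k
  extend : ∀ v → ∑ (allFin m) (λ x → if injective? (x ∷ v) then c else 0ℚ)
               ≡ (m ∸ k) · (if injective? v then c else 0ℚ)
  extend v with injective? v in inj
  ... | true  = trans (∑-cong (allFin m) λ x → cong (if_then c else 0ℚ) (∧-identityʳ (not (x ∈ᵇ v))))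
                      (trans (∑-count m (λ x → not (x ∈ᵇ v)) c) (cong (_· c) (countFin-∉ᵇ v inj)))
  ... | false = trans (∑-cong (allFin m) λ x → cong (if_then c else 0ℚ) (∧-zeroʳ (not (x ∈ᵇ v))))
                      (trans (∑-zero (allFin m)) (sym (·-zeroʳ (m ∸ k))))

∑-permutations : ∀ m c → ∑ (permutations m) (λ _ → c) ≡ (m !) · c
∑-permutations m c = begin
  ∑ (permutations m) (λ _ → c)
    ≡⟨ ∑-filter isPerm (allVecs (allFin m) m) (λ _ → c) ⟩
  ∑ (allVecs (allFin m) m) (λ π → if isPerm π then c else 0ℚ)
    ≡⟨ ∑-cong (allVecs (allFin m) m) (λ π → cong (if_then c else 0ℚ) (isPerm≡injective? π)) ⟩
  ∑ (allVecs (allFin m) m) (λ π → if injective? π then c else 0ℚ)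
    ≡⟨ ∑-injective m m c ⟩
  (m P′ m) · c
    ≡⟨ cong (_· c) mP′m≡m! ⟩
  (m !) · c
    ∎
  where
  open ≡-Reasoning
  mP′m≡m! : m P′ m ≡ m !
  mP′m≡m! = trans (cong (if_then m P′ m else 0) (sym (≤ᵇ-true⁺ (≤-refl {m})))) (nPn≡n! m)

toℚᵘ-·-1 : ∀ k → toℚᵘ (k · 1ℚ) ℚᵘ.≃ ℚᵘ.mkℚᵘ (ℤ.+ k) 0
toℚᵘ-·-1 zero    = ℚᵘ.*≡* refl
toℚᵘ-·-1 (suc k) = ℚᵘ.≃-trans (toℚᵘ-homo-+ 1ℚ (k · 1ℚ))
  (ℚᵘ.≃-trans (ℚᵘ.+-cong (ℚᵘ.≃-refl {toℚᵘ 1ℚ}) (toℚᵘ-·-1 k)) (ℚᵘ.*≡* cross))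
  where
  cross : ℚᵘ.↥ (toℚᵘ 1ℚ ℚᵘ.+ ℚᵘ.mkℚᵘ (ℤ.+ k) 0) ℤ.* ℚᵘ.↧ (ℚᵘ.mkℚᵘ (ℤ.+ suc k) 0)
        ≡ ℤ.+ suc k ℤ.* ℚᵘ.↧ (toℚᵘ 1ℚ ℚᵘ.+ ℚᵘ.mkℚᵘ (ℤ.+ k) 0)
  cross rewrite ℤ.*-identityʳ (ℤ.+ k) = refl

1/k*k≡1 : ∀ k → (ℤ.+ 1 / suc k) * (suc k · 1ℚ) ≡ 1ℚ
1/k*k≡1 k = toℚᵘ-injective (ℚᵘ.≃-trans (toℚᵘ-homo-* (ℤ.+ 1 / suc k) (suc k · 1ℚ))
  (ℚᵘ.≃-trans (ℚᵘ.*-cong (toℚᵘ-fromℚᵘ (ℚᵘ.mkℚᵘ (ℤ.+ 1) k)) (toℚᵘ-·-1 (suc k)))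
               (ℚᵘ.*≡* cross)))
  where
  cross : ℚᵘ.↥ (ℚᵘ.mkℚᵘ (ℤ.+ 1) k ℚᵘ.* ℚᵘ.mkℚᵘ (ℤ.+ suc k) 0) ℤ.* ℚᵘ.↧ (toℚᵘ 1ℚ)
        ≡ ℚᵘ.↥ (toℚᵘ 1ℚ) ℤ.* ℚᵘ.↧ (ℚᵘ.mkℚᵘ (ℤ.+ 1) k ℚᵘ.* ℚᵘ.mkℚᵘ (ℤ.+ suc k) 0)
  cross = cong (λ z → ℤ.+ suc z) (trans (ℕ.*-identityʳ (k +ℕ 0)) (trans (ℕ.+-identityʳ k)
            (sym (trans (ℕ.+-identityʳ (k *ℕ 1)) (ℕ.*-identityʳ k)))))

average-constant : ∀ k .{{_ : NonZero k}} c → (ℤ.+ 1 / k) * (k · c) ≡ c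
average-constant (suc k) c = begin
  (ℤ.+ 1 / suc k) * (suc k · c)          ≡⟨ cong ((ℤ.+ 1 / suc k) *_) (·-as-* (suc k) c) ⟩
  (ℤ.+ 1 / suc k) * ((suc k · 1ℚ) * c)  ≡⟨ *-assoc (ℤ.+ 1 / suc k) (suc k · 1ℚ) c ⟨
  ((ℤ.+ 1 / suc k) * (suc k · 1ℚ)) * c  ≡⟨ cong (_* c) (1/k*k≡1 k) ⟩
  1ℚ * c                               ≡⟨ *-identityˡ c ⟩
  c                                    ∎
  where open ≡-Reasoning

-- Paths, components and forests

module _ {n m : ℕ} (G : Graph n m) where

  ends₁ ends₂ : Fin m → Fin n
  ends₁ e = proj₁ (G e)
  ends₂ e = proj₂ (G e)

  data Path (A : EdgeSet m) (u : Fin n) : Fin n → Set where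
    here : Path A u u
    fwd  : ∀ e → lookup A e ≡ true → Path A u (ends₁ e) → Path A u (ends₂ e)
    bwd  : ∀ e → lookup A e ≡ true → Path A u (ends₂ e) → Path A u (ends₁ e)

  length : ∀ {A u v} → Path A u v → ℕ
  length here        = 0
  length (fwd _ _ p) = suc (length p)
  length (bwd _ _ p) = suc (length p)

  _++ₚ_ : ∀ {A u v w} → Path A u v → Path A v w → Path A u w
  p ++ₚ here        = p
  p ++ₚ fwd e x q   = fwd e x (p ++ₚ q)
  p ++ₚ bwd e x q   = bwd e x (p ++ₚ q)

  reverseₚ : ∀ {A u v} → Path A u v → Path A v u
  reverseₚ here        = here
  reverseₚ (fwd e x p) = bwd e x here ++ₚ reverseₚ p
  reverseₚ (bwd e x p) = fwd e x here ++ₚ reverseₚ p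

  edgeₚ : ∀ {A} e → lookup A e ≡ true → Path A (ends₁ e) (ends₂ e)
  edgeₚ e x = fwd e x here

  Path-mono : ∀ {A B u v} → A ⊆ B → Path A u v → Path B u v
  Path-mono s here        = here
  Path-mono s (fwd e x p) = fwd e (s e x) (Path-mono s p)
  Path-mono s (bwd e x p) = bwd e (s e x) (Path-mono s p)

  Path-reroute : ∀ {A B u v} → (∀ e → lookup A e ≡ true → Path B (ends₁ e) (ends₂ e)) →
    Path A u v → Path B u v
  Path-reroute h here        = here
  Path-reroute h (fwd e x p) = Path-reroute h p ++ₚ h e x
  Path-reroute h (bwd e x p) = Path-reroute h p ++ₚ reverseₚ (h e x)

  Crossing : EdgeSet m → Fin n → Fin n → Fin n → Fin n → Set
  Crossing A x y u v = (Path A u x × Path A y v) ⊎ (Path A u y × Path A x v)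

  PathVia : EdgeSet m → Fin n → Fin n → Fin n → Fin n → Set
  PathVia A x y u v = Path A u v ⊎ Crossing A x y u v

  Crossing⇒Path : ∀ {A B x y u v} → A ⊆ B → Path B u v → Crossing A x y u v → Path B x y
  Crossing⇒Path s p (inj₁ (q , r)) = reverseₚ (Path-mono s q) ++ₚ (p ++ₚ reverseₚ (Path-mono s r))
  Crossing⇒Path s p (inj₂ (q , r)) = Path-mono s r ++ₚ (reverseₚ p ++ₚ Path-mono s q)

  PathVia-swap : ∀ {A x y u v} → PathVia A x y u v → PathVia A y x u v
  PathVia-swap (inj₁ p)        = inj₁ p
  PathVia-swap (inj₂ (inj₁ q)) = inj₂ (inj₂ q)
  PathVia-swap (inj₂ (inj₂ q)) = inj₂ (inj₁ q)

  Path-addEdge⁻ : ∀ {A f u v} → Path (addEdge A f) u v → PathVia A (ends₁ f) (ends₂ f) u v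
  Path-addEdge⁻ here = inj₁ here
  Path-addEdge⁻ {A} {f} (fwd e x p) with lookup-addEdge-true⁻ A x | Path-addEdge⁻ p
  ... | inj₂ a    | inj₁ q              = inj₁ (fwd e a q)
  ... | inj₂ a    | inj₂ (inj₁ (q , r)) = inj₂ (inj₁ (q , fwd e a r))
  ... | inj₂ a    | inj₂ (inj₂ (q , r)) = inj₂ (inj₂ (q , fwd e a r))
  ... | inj₁ refl | inj₁ q              = inj₂ (inj₁ (q , here))
  ... | inj₁ refl | inj₂ (inj₁ (q , r)) = inj₂ (inj₁ (q , here))
  ... | inj₁ refl | inj₂ (inj₂ (q , r)) = inj₁ q
  Path-addEdge⁻ {A} {f} (bwd e x p) with lookup-addEdge-true⁻ A x | Path-addEdge⁻ p
  ... | inj₂ a    | inj₁ q              = inj₁ (bwd e a q)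
  ... | inj₂ a    | inj₂ (inj₁ (q , r)) = inj₂ (inj₁ (q , bwd e a r))
  ... | inj₂ a    | inj₂ (inj₂ (q , r)) = inj₂ (inj₂ (q , bwd e a r))
  ... | inj₁ refl | inj₁ q              = inj₂ (inj₂ (q , here))
  ... | inj₁ refl | inj₂ (inj₁ (q , r)) = inj₁ q
  ... | inj₁ refl | inj₂ (inj₂ (q , r)) = inj₂ (inj₂ (q , here))

  Path-addEdge⁺ : ∀ {A f u v} → PathVia A (ends₁ f) (ends₂ f) u v → Path (addEdge A f) u v
  Path-addEdge⁺ {A} {f} (inj₁ p) = Path-mono (⊆-addEdge A f) p
  Path-addEdge⁺ {A} {f} (inj₂ (inj₁ (p , q))) =
    fwd f (lookup-addEdge-self A f) (Path-mono (⊆-addEdge A f) p) ++ₚ Path-mono (⊆-addEdge A f) q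
  Path-addEdge⁺ {A} {f} (inj₂ (inj₂ (p , q))) =
    bwd f (lookup-addEdge-self A f) (Path-mono (⊆-addEdge A f) p) ++ₚ Path-mono (⊆-addEdge A f) q

  Path-∅ : ∀ {u v} → Path ∅ u v → u ≡ v
  Path-∅ here = refl
  Path-∅ (fwd e x p) with () ← trans (sym x) (lookup-∅ e)
  Path-∅ (bwd e x p) with () ← trans (sym x) (lookup-∅ e)

  reachStep : EdgeSet m → ℕ → Fin n → Fin n → Fin m → Bool
  reachStep A k u v e = lookup A e ∧ ((reachW G A k u (ends₁ e) ∧ (ends₂ e == v))
                                    ∨ (reachW G A k u (ends₂ e) ∧ (ends₁ e == v)))

  private
    lastStep : ∀ A k u a b {v} → (reachW G A k u a ≡ true → Path A u b) →
      (reachW G A k u a ∧ (b == v)) ≡ true → Path A u v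
    lastStep A k u a b {v} toPath t with ∧-true⁻ {reachW G A k u a} t
    ... | ra , bv with refl ← ==-true⁻ {i = b} {v} bv = toPath ra

  reachW⇒Path : ∀ A k u v → reachW G A k u v ≡ true → Path A u v
  reachW⇒Path A zero u v h with refl ← ==-true⁻ {i = u} {v} h = here
  reachW⇒Path A (suc k) u v h with ∨-true⁻ {reachW G A k u v} h
  ... | inj₁ q = reachW⇒Path A k u v q
  ... | inj₂ q with anyFin-true⁻ m (reachStep A k u v) q
  ... | e , r with ∧-true⁻ {lookup A e} r
  ... | ae , s with ∨-true⁻ {reachW G A k u (ends₁ e) ∧ (ends₂ e == v)} s
  ... | inj₁ t = lastStep A k u (ends₁ e) (ends₂ e) (λ ra → fwd e ae (reachW⇒Path A k u _ ra)) t
  ... | inj₂ t = lastStep A k u (ends₂ e) (ends₁ e) (λ ra → bwd e ae (reachW⇒Path A k u _ ra)) t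

  Path⇒reachW : ∀ {A u v} (p : Path A u v) → reachW G A (length p) u v ≡ true
  Path⇒reachW {u = u} here = ==-refl u
  Path⇒reachW (fwd e x p) = ∨-trueʳ _ (anyFin-true⁺ m _ e
    (∧-true⁺ x (∨-trueˡ _ (∧-true⁺ (Path⇒reachW p) (==-refl (ends₂ e))))))
  Path⇒reachW (bwd e x p) = ∨-trueʳ _ (anyFin-true⁺ m _ e
    (∧-true⁺ x (∨-trueʳ _ (∧-true⁺ (Path⇒reachW p) (==-refl (ends₁ e))))))

  reachW-mono : ∀ A u v {k k'} → k ≤ k' → reachW G A k u v ≡ true → reachW G A k' u v ≡ true
  reachW-mono A u v {k} {k'} le h = subst (λ j → reachW G A j u v ≡ true) (m∸n+n≡m le) (go (k' ∸ k))
    where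
    go : ∀ j → reachW G A (j +ℕ k) u v ≡ true
    go zero    = h
    go (suc j) = ∨-trueˡ _ (go j)

  ReachStable : EdgeSet m → Fin n → ℕ → Set
  ReachStable A u k = ∀ v → reachW G A k u v ≡ reachW G A (suc k) u v

  ReachStable-suc : ∀ A u k → ReachStable A u k → ReachStable A u (suc k)
  ReachStable-suc A u k h v = cong₂ _∨_ (h v) (anyFin-cong m λ e →
    cong (lookup A e ∧_) (cong₂ _∨_ (cong (_∧ (ends₂ e == v)) (h (ends₁ e)))
                                    (cong (_∧ (ends₁ e == v)) (h (ends₂ e)))))

  reachW-stable : ∀ A u k → ReachStable A u k → ∀ j v → reachW G A (j +ℕ k) u v ≡ reachW G A k u v
  reachW-stable A u k h zero    v = refl
  reachW-stable A u k h (suc j) v = trans (sym (stable j v)) (reachW-stable A u k h j v)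
    where
    stable : ∀ j → ReachStable A u (j +ℕ k)
    stable zero    = h
    stable (suc j) = ReachStable-suc A u (j +ℕ k) (stable j)

  -- The set reachable in j steps grows at every step until it stabilises, so it stabilises within n steps.
  reachW-grows : ∀ A u j → suc j ≤ countFin n (reachW G A j u) ⊎ ∃ λ k → k ≤ j × ReachStable A u k
  reachW-grows A u zero = inj₁ (countFin-positive n _ u (==-refl u))
  reachW-grows A u (suc j) with reachW-grows A u j
  ... | inj₂ (k , le , s) = inj₂ (k , m≤n⇒m≤1+n le , s)
  ... | inj₁ le with allFinB n (λ v → reachW G A (suc j) u v ⇒ᵇ reachW G A j u v) in stable
  ... | true  = inj₂ (j , m≤n⇒m≤1+n ≤-refl , λ v →
                  Bool-ext (∨-trueˡ _) (⇒ᵇ-true⁻ (allFinB-true⁻ n _ stable v)))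
  ... | false with allFinB-false⁻ n _ stable
  ... | v , r with ⇒ᵇ-false⁻ r
  ... | new , old = inj₁ (≤-trans (s≤s le) (countFin-strict n _ _ (λ v → ∨-trueˡ _) v old new))

  reachW-stabilises : ∀ A u → ∃ λ k → k ≤ n × ReachStable A u k
  reachW-stabilises A u with reachW-grows A u n
  ... | inj₂ r  = r
  ... | inj₁ le = ⊥-elim (<-irrefl refl (≤-trans le (countFin-≤ n _)))

  reachW⇒connectedIn : ∀ A k u v → reachW G A k u v ≡ true → connectedIn G A u v ≡ true
  reachW⇒connectedIn A k u v h with reachW-stabilises A u
  ... | k₀ , k₀≤n , s = reachW-mono A u v k₀≤n
    (trans (sym (reachW-stable A u k₀ s k v)) (reachW-mono A u v (m≤m+n k k₀) h))

  Path⇒connectedIn : ∀ {A u v} → Path A u v → connectedIn G A u v ≡ true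
  Path⇒connectedIn {A} {u} {v} p = reachW⇒connectedIn A (length p) u v (Path⇒reachW p)

  connectedIn⇒Path : ∀ {A u v} → connectedIn G A u v ≡ true → Path A u v
  connectedIn⇒Path {A} {u} {v} = reachW⇒Path A n u v

  ¬Path⇒connectedIn : ∀ {A u v} → ¬ Path A u v → connectedIn G A u v ≡ false
  ¬Path⇒connectedIn ¬p = ¬true⇒false λ h → ¬p (connectedIn⇒Path h)

  connectedIn⇒¬Path : ∀ {A u v} → connectedIn G A u v ≡ false → ¬ Path A u v
  connectedIn⇒¬Path h p = true≢false (Path⇒connectedIn p) h

  Path? : ∀ A u v → Path A u v ⊎ ¬ Path A u v
  Path? A u v with connectedIn G A u v in c
  ... | true  = inj₁ (connectedIn⇒Path c)
  ... | false = inj₂ (connectedIn⇒¬Path c)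

  isRoot : EdgeSet m → Fin n → Bool
  isRoot A v = not (anyFin n (λ u → (toℕ u <ᵇ toℕ v) ∧ connectedIn G A u v))

  isRoot-true⁻ : ∀ {A v} → isRoot A v ≡ true → ∀ u → toℕ u < toℕ v → ¬ Path A u v
  isRoot-true⁻ h u lt p =
    true≢false (anyFin-true⁺ n _ u (∧-true⁺ (<ᵇ-true⁺ lt) (Path⇒connectedIn p))) (not-true⁻ h)

  isRoot-true⁺ : ∀ {A v} → (∀ u → toℕ u < toℕ v → ¬ Path A u v) → isRoot A v ≡ true
  isRoot-true⁺ {A} {v} f = cong not (anyFin-false⁺ n _ λ u → ¬true⇒false λ r →
    f u (<ᵇ-true⁻ (proj₁ (∧-true⁻ r))) (connectedIn⇒Path (proj₂ (∧-true⁻ {toℕ u <ᵇ toℕ v} r))))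

  isRoot-false⁻ : ∀ {A v} → isRoot A v ≡ false → ∃ λ u → toℕ u < toℕ v × Path A u v
  isRoot-false⁻ {A} {v} h with anyFin-true⁻ n _ (not-false⁻ h)
  ... | u , r = u , <ᵇ-true⁻ (proj₁ (∧-true⁻ r)) , connectedIn⇒Path (proj₂ (∧-true⁻ {toℕ u <ᵇ toℕ v} r))

  root-exists : ∀ A v → ∃ λ r → isRoot A r ≡ true × Path A r v
  root-exists A v = go n v (toℕ<n v)
    where
    go : ∀ b v → toℕ v < b → ∃ λ r → isRoot A r ≡ true × Path A r v
    go (suc b) v (s≤s lt) with isRoot A v in eq
    ... | true = v , eq , here
    ... | false with isRoot-false⁻ eq
    ... | u , u<v , p with go b u (≤-trans u<v lt)
    ... | r , root , q = r , root , q ++ₚ p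

  isRoot-minimal : ∀ {A r w} → isRoot A r ≡ true → Path A w r → toℕ r ≤ toℕ w
  isRoot-minimal {r = r} {w} h p with <-cmp (toℕ r) (toℕ w)
  ... | tri< lt _ _ = <⇒≤ lt
  ... | tri≈ _ eq _ = ≤-reflexive eq
  ... | tri> _ _ gt = ⊥-elim (isRoot-true⁻ h w gt p)

  isRoot-unique : ∀ {A r r'} → isRoot A r ≡ true → isRoot A r' ≡ true → Path A r r' → r ≡ r'
  isRoot-unique {r = r} {r'} h h' p with <-cmp (toℕ r) (toℕ r')
  ... | tri< lt _ _ = ⊥-elim (isRoot-true⁻ h' r lt p)
  ... | tri≈ _ eq _ = toℕ-injective eq
  ... | tri> _ _ gt = ⊥-elim (isRoot-true⁻ h r' gt (reverseₚ p))

  isRoot-anti : ∀ {A B} → A ⊆ B → ∀ v → isRoot B v ≡ true → isRoot A v ≡ true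
  isRoot-anti s v h = isRoot-true⁺ λ u lt p → isRoot-true⁻ h u lt (Path-mono s p)

  components-anti : ∀ {A B} → A ⊆ B → components G B ≤ components G A
  components-anti {A} {B} s = countFin-mono n (isRoot B) (isRoot A) (isRoot-anti s)

  components-≡⇒isRoot : ∀ {A B} → A ⊆ B → components G A ≡ components G B →
    ∀ w → isRoot A w ≡ true → isRoot B w ≡ true
  components-≡⇒isRoot {A} {B} s eq w hA with isRoot B w in hB
  ... | true  = refl
  ... | false = ⊥-elim (<-irrefl refl
    (≤-trans (countFin-strict n (isRoot B) (isRoot A) (isRoot-anti s) w hB hA) (≤-reflexive eq)))

  components-≡⇒Path : ∀ {A B} → A ⊆ B → components G A ≡ components G B →
    ∀ {u v} → Path B u v → Path A u v
  components-≡⇒Path {A} {B} s eq {u} {v} p with Path? A u v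
  ... | inj₁ q = q
  ... | inj₂ ¬q with root-exists A u | root-exists A v
  ... | ru , hu , pu | rv , hv , pv
    with refl ← isRoot-unique (components-≡⇒isRoot s eq ru hu) (components-≡⇒isRoot s eq rv hv)
                              (Path-mono s pu ++ₚ (p ++ₚ reverseₚ (Path-mono s pv)))
    = ⊥-elim (¬q (reverseₚ pu ++ₚ pv))

  Path-addEdge-inside : ∀ {A f u v} → Path A (ends₁ f) (ends₂ f) → Path (addEdge A f) u v → Path A u v
  Path-addEdge-inside {A} {f} pf = Path-reroute λ e x → case lookup-addEdge-true⁻ A x of λ where
    (inj₁ refl) → pf
    (inj₂ a)    → edgeₚ e a

  components-addEdge-inside : ∀ A f → Path A (ends₁ f) (ends₂ f) → components G (addEdge A f) ≡ components G A
  components-addEdge-inside A f pf = countFin-cong n λ v → Bool-ext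
    (isRoot-anti (⊆-addEdge A f) v)
    (λ h → isRoot-true⁺ λ u lt p → isRoot-true⁻ h u lt (Path-addEdge-inside pf p))

  private
    module Bridge (A : EdgeSet m) (f : Fin m) (x y : Fin n)
      (split : ∀ {u v} → Path (addEdge A f) u v → PathVia A x y u v)
      (join : ∀ {u v} → Path A u x → Path A y v → Path (addEdge A f) u v)
      (rx ry : Fin n) (hx : isRoot A rx ≡ true) (hy : isRoot A ry ≡ true)
      (px : Path A rx x) (py : Path A ry y) (rx<ry : toℕ rx < toℕ ry) where

      ry-not-root : isRoot (addEdge A f) ry ≡ false
      ry-not-root = ¬true⇒false λ h → isRoot-true⁻ h rx rx<ry (join px (reverseₚ py))

      other-roots : ∀ v → ¬ v ≡ ry → isRoot (addEdge A f) v ≡ isRoot A v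
      other-roots v v≢ry = Bool-ext (isRoot-anti (⊆-addEdge A f) v) λ h →
        isRoot-true⁺ λ u u<v p → noSmaller h u u<v (split p)
        where
        noSmaller : isRoot A v ≡ true → ∀ u → toℕ u < toℕ v → ¬ PathVia A x y u v
        noSmaller h u u<v (inj₁ p) = isRoot-true⁻ h u u<v p
        noSmaller h u u<v (inj₂ (inj₁ (p , q))) = v≢ry (isRoot-unique h hy (reverseₚ q ++ₚ reverseₚ py))
        noSmaller h u u<v (inj₂ (inj₂ (p , q)))
          with refl ← isRoot-unique h hx (reverseₚ q ++ₚ reverseₚ px) =
          <-irrefl refl (<-trans (≤-<-trans (isRoot-minimal hy (p ++ₚ reverseₚ py)) u<v) rx<ry)

      components-drop : components G A ≡ suc (components G (addEdge A f))
      components-drop = countFin-insert n (isRoot (addEdge A f)) (isRoot A) ry other-roots ry-not-root hy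

  components-addEdge-bridge : ∀ A f → ¬ Path A (ends₁ f) (ends₂ f) →
    components G A ≡ suc (components G (addEdge A f))
  components-addEdge-bridge A f ¬pf with root-exists A (ends₁ f) | root-exists A (ends₂ f)
  ... | ra , ha , pa | rb , hb , pb with <-cmp (toℕ ra) (toℕ rb)
  ... | tri< lt _ _ = Bridge.components-drop A f (ends₁ f) (ends₂ f) Path-addEdge⁻
                        (λ p q → Path-addEdge⁺ (inj₂ (inj₁ (p , q)))) ra rb ha hb pa pb lt
  ... | tri≈ _ eq _ =
    ⊥-elim (¬pf (reverseₚ pa ++ₚ subst (λ r → Path A r (ends₂ f)) (sym (toℕ-injective eq)) pb))
  ... | tri> _ _ gt = Bridge.components-drop A f (ends₂ f) (ends₁ f) (λ p → PathVia-swap (Path-addEdge⁻ p))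
                        (λ p q → Path-addEdge⁺ (inj₂ (inj₂ (p , q)))) rb ra hb ha pb pa gt

  components-∅ : components G ∅ ≡ n
  components-∅ = countFin-all n (isRoot ∅) λ v → isRoot-true⁺ λ u lt p → <-irrefl (cong toℕ (Path-∅ p)) lt

  Acyclic : EdgeSet m → Set
  Acyclic X = ∀ e → lookup X e ≡ true → ¬ Path (removeEdge X e) (ends₁ e) (ends₂ e)

  isAcyclic-true⁻ : ∀ X → isAcyclic G X ≡ true → Acyclic X
  isAcyclic-true⁻ X h e xe p =
    true≢false (Path⇒connectedIn p) (not-true⁻ (⇒ᵇ-true⁻ (allFinB-true⁻ m _ h e) xe))

  isAcyclic-true⁺ : ∀ X → Acyclic X → isAcyclic G X ≡ true
  isAcyclic-true⁺ X a =
    allFinB-true⁺ m _ λ e → ⇒ᵇ-true⁺ (lookup X e) λ xe → cong not (¬Path⇒connectedIn (a e xe))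

  Acyclic-anti : ∀ {X Y} → Y ⊆ X → Acyclic X → Acyclic Y
  Acyclic-anti {X} {Y} s a e ye p = a e (s e ye) (Path-mono (removeEdge-mono {A = Y} {B = X} e s) p)

  Acyclic-∅ : Acyclic ∅
  Acyclic-∅ e h with () ← trans (sym h) (lookup-∅ {m} e)

  Acyclic-addEdge : ∀ C f → Acyclic C → ¬ Path C (ends₁ f) (ends₂ f) → Acyclic (addEdge C f)
  Acyclic-addEdge C f a ¬pf e he p with e ≟ f
  ... | yes refl = ¬pf (Path-mono (removeEdge-addEdge-⊆ C e) p)
  ... | no e≢f =
    [ a e e∈C , (λ cross → ¬pf (Crossing⇒Path (removeEdge-⊆ C e) (edgeₚ e e∈C) cross)) ]′
      (Path-addEdge⁻ (subst (λ X → Path X (ends₁ e) (ends₂ e)) (removeEdge-addEdge-comm C e≢f) p))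
    where e∈C = trans (sym (lookup-addEdge-other C e≢f)) he

  components-addEdge-≤ : ∀ A f → components G A ≤ suc (components G (addEdge A f))
  components-addEdge-≤ A f with Path? A (ends₁ f) (ends₂ f)
  ... | inj₁ pf  = m≤n⇒m≤1+n (≤-reflexive (sym (components-addEdge-inside A f pf)))
  ... | inj₂ ¬pf = ≤-reflexive (components-addEdge-bridge A f ¬pf)

  components-≤-∪-size : ∀ C A → components G C ≤ components G (A ∪ C) +ℕ size A
  components-≤-∪-size C = size-induction (λ A → components G C ≤ components G (A ∪ C) +ℕ size A)
    (λ A empty → ≤-trans (≤-reflexive (cong (components G) (sym (empty-∪ A C empty)))) (m≤m+n _ _))
    (λ A f af ih → ≤-trans ih (step A f af))
    where
    step : ∀ A f → lookup A f ≡ true →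
      components G (removeEdge A f ∪ C) +ℕ size (removeEdge A f) ≤ components G (A ∪ C) +ℕ size A
    step A f af rewrite size-removeEdge A f af | ℕ.+-suc (components G (A ∪ C)) (size (removeEdge A f)) =
      +-monoˡ-≤ (size (removeEdge A f)) (≤-trans (components-addEdge-≤ (removeEdge A f ∪ C) f)
        (≤-reflexive (cong (λ X → suc (components G X))
          (trans (sym (addEdge-∪ (removeEdge A f) C f)) (cong (_∪ C) (addEdge-removeEdge A f af))))))

  Path-removeEdge-both : ∀ X {i j a b} → Acyclic X → lookup X i ≡ true → ¬ i ≡ j →
    Path (removeEdge X i) a b → Path (removeEdge X j) a b → Path (removeEdge (removeEdge X i) j) a b
  Path-removeEdge-both X {i} {j} {a} {b} acyclic xi i≢j pi pj with Path? (removeEdge (removeEdge X i) j) a b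
  ... | inj₁ p = p
  ... | inj₂ ¬p = ⊥-elim
    ([ ¬p , (λ cross → acyclic i xi (Crossing⇒Path (removeEdge-⊆ (removeEdge X i) j) pi cross)) ]′
      (Path-addEdge⁻ (subst (λ Y → Path Y a b) (sym X-j) pj)))
    where
    X-j : addEdge (removeEdge (removeEdge X i) j) i ≡ removeEdge X j
    X-j = trans (sym (removeEdge-addEdge-comm (removeEdge X i) (λ j≡i → i≢j (sym j≡i))))
                (cong (λ Y → removeEdge Y j) (addEdge-removeEdge X i xi))

  -- In a forest T ∪ C the a–b path is unique, so avoiding each edge of T separately means avoiding T.
  forest-Path-avoiding : ∀ a b C T → Disjoint T C → Acyclic (T ∪ C) → Path (T ∪ C) a b →
    (∀ i → lookup T i ≡ true → Path (removeEdge (T ∪ C) i) a b) → Path C a b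
  forest-Path-avoiding a b C = size-induction P base step
    where
    P : EdgeSet m → Set
    P T = Disjoint T C → Acyclic (T ∪ C) → Path (T ∪ C) a b →
          (∀ i → lookup T i ≡ true → Path (removeEdge (T ∪ C) i) a b) → Path C a b
    base : ∀ T → (∀ i → lookup T i ≡ false) → P T
    base T empty _ _ p _ = subst (λ X → Path X a b) (empty-∪ T C empty) p
    step : ∀ T i → lookup T i ≡ true → P (removeEdge T i) → P T
    step T i ti ih disjoint acyclic p avoid rewrite removeEdge-∪ T C (disjoint i ti) =
      ih (λ e h → disjoint e (removeEdge-⊆ T i e h))
         (Acyclic-anti (removeEdge-⊆ (T ∪ C) i) acyclic)
         (avoid i ti)
         λ j tj → Path-removeEdge-both (T ∪ C) acyclic (⊆-∪ˡ T C i ti) (i≢j j tj) (avoid i ti)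
                    (avoid j (removeEdge-⊆ T i j tj))
      where
      i≢j : ∀ j → lookup (removeEdge T i) j ≡ true → ¬ i ≡ j
      i≢j j tj refl = true≢false tj (lookup-removeEdge-self T i)

  -- The activity expansion of the Tutte polynomial of a minor

  module ActivityExpansion (π : Vec (Fin m) m) (x y : ℚ) where

    rank : Fin m → ℕ
    rank e = toℕ (lookup π e)

    tutteTerm : EdgeSet m → EdgeSet m → EdgeSet m → ℚ
    tutteTerm S C A = powℚ (x - 1ℚ) (components G (A ∪ C) ∸ components G (S ∪ C))
                    * powℚ (y - 1ℚ) ((components G (A ∪ C) +ℕ size A) ∸ components G C)

    -- The Tutte polynomial of the minor (G / C) | S, for C acyclic and disjoint from S: a set A ⊆ S has the
    -- components of A ∪ C, and the vertices of G / C are the components of C.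
    relTutte : EdgeSet m → EdgeSet m → ℚ
    relTutte S C = ∑⊆ S (tutteTerm S C)

    separates : EdgeSet m → Fin m → Bool
    separates X j = not (connectedIn G X (ends₁ j) (ends₂ j))

    smallerInCut : EdgeSet m → EdgeSet m → EdgeSet m → Fin m → Fin m → Bool
    smallerInCut S C T i j =
      (lookup S j ∧ (not (lookup T j) ∧ separates (removeEdge T i ∪ C) j)) ⇒ᵇ (rank j <ᵇ rank i)

    smallerInCycle : EdgeSet m → EdgeSet m → Fin m → Fin m → Bool
    smallerInCycle C T j i = (lookup T i ∧ separates (removeEdge T i ∪ C) j) ⇒ᵇ (rank i <ᵇ rank j)

    internallyActive : EdgeSet m → EdgeSet m → EdgeSet m → Fin m → Bool
    internallyActive S C T i = lookup T i ∧ allFinB m (smallerInCut S C T i)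

    externallyActive : EdgeSet m → EdgeSet m → EdgeSet m → Fin m → Bool
    externallyActive S C T j = lookup S j ∧ (not (lookup T j) ∧ allFinB m (smallerInCycle C T j))

    internalActivity externalActivity : EdgeSet m → EdgeSet m → EdgeSet m → ℕ
    internalActivity S C T = countFin m (internallyActive S C T)
    externalActivity S C T = countFin m (externallyActive S C T)

    isBasis : EdgeSet m → EdgeSet m → EdgeSet m → Bool
    isBasis S C T = isAcyclic G (T ∪ C) ∧ ⌊ components G (T ∪ C) ≟ℕ components G (S ∪ C) ⌋

    activityWeight : EdgeSet m → EdgeSet m → EdgeSet m → ℚ
    activityWeight S C T =
      if isBasis S C T then powℚ x (internalActivity S C T) * powℚ y (externalActivity S C T) else 0ℚ

    activityPolynomial : EdgeSet m → EdgeSet m → ℚ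
    activityPolynomial S C = ∑⊆ S (activityWeight S C)

    separates-false⁺ : ∀ X j → Path X (ends₁ j) (ends₂ j) → separates X j ≡ false
    separates-false⁺ X j p = cong not (Path⇒connectedIn p)

    separates-true⁺ : ∀ X j → ¬ Path X (ends₁ j) (ends₂ j) → separates X j ≡ true
    separates-true⁺ X j ¬p = cong not (¬Path⇒connectedIn ¬p)

    isBasis-true⁻ : ∀ S C T → isBasis S C T ≡ true →
      Acyclic (T ∪ C) × components G (T ∪ C) ≡ components G (S ∪ C)
    isBasis-true⁻ S C T h =
      isAcyclic-true⁻ (T ∪ C) (proj₁ (∧-true⁻ h)) , ⌊≟ℕ⌋-true⁻ (proj₂ (∧-true⁻ {isAcyclic G (T ∪ C)} h))

    module DeletionContraction (S : EdgeSet m) (e₀ : Fin m) (e₀∉S : lookup S e₀ ≡ false)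
      (e₀-min : ∀ e → lookup S e ≡ true → rank e₀ < rank e)
      (C : EdgeSet m) (disjoint : Disjoint (addEdge S e₀) C) (acyclicC : Acyclic C) where

      S⁺ C⁺ : EdgeSet m
      S⁺ = addEdge S e₀
      C⁺ = addEdge C e₀

      a b : Fin n
      a = ends₁ e₀
      b = ends₂ e₀

      e₀∉C : lookup C e₀ ≡ false
      e₀∉C = disjoint e₀ (lookup-addEdge-self S e₀)

      e₀∈S⁺ : lookup S⁺ e₀ ≡ true
      e₀∈S⁺ = lookup-addEdge-self S e₀

      S⊆S⁺ : S ⊆ S⁺
      S⊆S⁺ = ⊆-addEdge S e₀

      Disjoint-S-C : Disjoint S C
      Disjoint-S-C e h = disjoint e (S⊆S⁺ e h)

      Disjoint-S-C⁺ : Disjoint S C⁺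
      Disjoint-S-C⁺ e h with e ≟ e₀
      ... | yes refl = ⊥-elim (true≢false h e₀∉S)
      ... | no ne    = trans (lookup-addEdge-other C ne) (Disjoint-S-C e h)

      e₀∉ : ∀ {T} → T ⊆ S → lookup T e₀ ≡ false
      e₀∉ T⊆S = ¬true⇒false λ h → true≢false (T⊆S e₀ h) e₀∉S

      removeEdge-addEdge-∪ : ∀ T {i} → ¬ i ≡ e₀ → removeEdge (addEdge T e₀) i ∪ C ≡ removeEdge T i ∪ C⁺
      removeEdge-addEdge-∪ T ne =
        trans (cong (_∪ C) (removeEdge-addEdge-comm T ne)) (addEdge-∪-swap (removeEdge T _) C e₀)

      components-S⁺ : Path (S ∪ C) a b → components G (S⁺ ∪ C) ≡ components G (S ∪ C)
      components-S⁺ p = trans (cong (components G) (addEdge-∪ S C e₀)) (components-addEdge-inside (S ∪ C) e₀ p)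

      components-S⁺-coloop : ¬ Path (S ∪ C) a b → components G (S ∪ C) ≡ suc (components G (S⁺ ∪ C))
      components-S⁺-coloop ¬p =
        trans (components-addEdge-bridge (S ∪ C) e₀ ¬p) (cong (λ X → suc (components G X)) (sym (addEdge-∪ S C e₀)))

      components-S⁺-C⁺ : components G (S⁺ ∪ C) ≡ components G (S ∪ C⁺)
      components-S⁺-C⁺ = cong (components G) (addEdge-∪-swap S C e₀)

      tutteTerm-delete : Path (S ∪ C) a b → ∀ A → tutteTerm S⁺ C A ≡ tutteTerm S C A
      tutteTerm-delete p A = cong (λ k → powℚ (x - 1ℚ) (components G (A ∪ C) ∸ k)
                                       * powℚ (y - 1ℚ) ((components G (A ∪ C) +ℕ size A) ∸ components G C))
                                  (components-S⁺ p)

      tutteTerm-contract : ¬ Path C a b → ∀ A → lookup A e₀ ≡ false →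
        tutteTerm S⁺ C (addEdge A e₀) ≡ tutteTerm S C⁺ A
      tutteTerm-contract ¬p A ae₀ = cong₂ _*_
        (cong (powℚ (x - 1ℚ)) (cong₂ _∸_ kA components-S⁺-C⁺))
        (cong (powℚ (y - 1ℚ)) (trans (cong₂ _∸_ (cong₂ _+ℕ_ kA (size-addEdge A e₀ ae₀))
                                                (components-addEdge-bridge C e₀ ¬p))
                                      (cong (_∸ suc (components G C⁺)) (ℕ.+-suc _ (size A)))))
        where
        kA : components G (addEdge A e₀ ∪ C) ≡ components G (A ∪ C⁺)
        kA = cong (components G) (addEdge-∪-swap A C e₀)

      tutteTerm-loop : Path C a b → ∀ A → lookup A e₀ ≡ false →
        tutteTerm S⁺ C (addEdge A e₀) ≡ (y - 1ℚ) * tutteTerm S C A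
      tutteTerm-loop p A ae₀ = trans (cong₂ _*_
        (cong (powℚ (x - 1ℚ)) (cong₂ _∸_ kA (components-S⁺ (Path-mono (⊆-∪ʳ S C) p))))
        (cong (powℚ (y - 1ℚ)) (trans (cong (_∸ components G C) (cong₂ _+ℕ_ kA (size-addEdge A e₀ ae₀)))
          (trans (cong (_∸ components G C) (ℕ.+-suc _ (size A))) (ℕ.+-∸-assoc 1 (components-≤-∪-size C A))))))
        (solve 3 (λ u Y v → u :* (Y :* v) := Y :* (u :* v)) refl
          (powℚ (x - 1ℚ) (components G (A ∪ C) ∸ components G (S ∪ C))) (y - 1ℚ)
          (powℚ (y - 1ℚ) ((components G (A ∪ C) +ℕ size A) ∸ components G C)))
        where
        kA : components G (addEdge A e₀ ∪ C) ≡ components G (A ∪ C)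
        kA = trans (cong (components G) (addEdge-∪ A C e₀))
                   (components-addEdge-inside (A ∪ C) e₀ (Path-mono (⊆-∪ʳ A C) p))

      tutteTerm-coloop : ¬ Path (S ∪ C) a b → ∀ A → A ⊆ S → tutteTerm S⁺ C A ≡ (x - 1ℚ) * tutteTerm S C⁺ A
      tutteTerm-coloop ¬p A A⊆S = trans (cong₂ _*_
        (cong (powℚ (x - 1ℚ)) (trans (cong₂ _∸_ kA components-S⁺-C⁺)
                                     (ℕ.+-∸-assoc 1 (components-anti (∪-monoˡ {A = A} {A' = S} C⁺ A⊆S)))))
        (cong (powℚ (y - 1ℚ)) (cong₂ _∸_ (cong (_+ℕ size A) kA)
                                         (components-addEdge-bridge C e₀ λ p → ¬p (Path-mono (⊆-∪ʳ S C) p)))))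
        (solve 3 (λ X u v → (X :* u) :* v := X :* (u :* v)) refl (x - 1ℚ)
          (powℚ (x - 1ℚ) (components G (A ∪ C⁺) ∸ components G (S ∪ C⁺)))
          (powℚ (y - 1ℚ) ((components G (A ∪ C⁺) +ℕ size A) ∸ components G C⁺)))
        where
        kA : components G (A ∪ C) ≡ suc (components G (A ∪ C⁺))
        kA = trans (components-addEdge-bridge (A ∪ C) e₀ (λ p → ¬p (Path-mono (∪-monoˡ {A = A} {A' = S} C A⊆S) p)))
                   (cong (λ X → suc (components G X)) (sym (∪-addEdge A C e₀)))

      e₀<ᵇ : ∀ i → lookup S i ≡ true → (rank e₀ <ᵇ rank i) ≡ true
      e₀<ᵇ i si = <ᵇ-true⁺ (e₀-min i si)

      ¬<ᵇe₀ : ∀ i → lookup S i ≡ true → (rank i <ᵇ rank e₀) ≡ false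
      ¬<ᵇe₀ i si = <ᵇ-false⁺ λ lt → <-irrefl refl (<-trans lt (e₀-min i si))

      internalActivity-delete : ∀ T → T ⊆ S → internalActivity S⁺ C T ≡ internalActivity S C T
      internalActivity-delete T T⊆S = countFin-cong m λ i → lemma i
        where
        lemma : ∀ i → internallyActive S⁺ C T i ≡ internallyActive S C T i
        lemma i with lookup T i in ti
        ... | false = refl
        ... | true  = allFinB-cong m λ j → candidate j
          where
          candidate : ∀ j → smallerInCut S⁺ C T i j ≡ smallerInCut S C T i j
          candidate j with j ≟ e₀
          ... | yes refl rewrite e₀<ᵇ i (T⊆S i ti) = trans (⇒ᵇ-zeroʳ _) (sym (⇒ᵇ-zeroʳ _))
          ... | no ne    rewrite lookup-addEdge-other S ne = refl

      externallyActive-other : ∀ T {j} → ¬ j ≡ e₀ → externallyActive S⁺ C T j ≡ externallyActive S C T j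
      externallyActive-other T ne = cong (_∧ _) (lookup-addEdge-other S ne)

      e₀-externallyActive : EdgeSet m → Bool
      e₀-externallyActive T = allFinB m (smallerInCycle C T e₀)

      externallyActive-e₀ : ∀ T → T ⊆ S → externallyActive S⁺ C T e₀ ≡ e₀-externallyActive T
      externallyActive-e₀ T T⊆S =
        cong₂ (λ s t → s ∧ (not t ∧ e₀-externallyActive T)) (lookup-addEdge-self S e₀) (e₀∉ {T} T⊆S)

      externallyActive-S-e₀ : ∀ T → externallyActive S C T e₀ ≡ false
      externallyActive-S-e₀ T = cong (_∧ (not (lookup T e₀) ∧ e₀-externallyActive T)) e₀∉S

      externalActivity-loop : Path C a b → ∀ T → T ⊆ S → externalActivity S⁺ C T ≡ suc (externalActivity S C T)
      externalActivity-loop p T T⊆S = countFin-insert m (externallyActive S C T) (externallyActive S⁺ C T) e₀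
        (λ j ne → sym (externallyActive-other T ne)) (externallyActive-S-e₀ T)
        (trans (externallyActive-e₀ T T⊆S) (allFinB-true⁺ m _ λ i → inNoCut i))
        where
        inNoCut : ∀ i → smallerInCycle C T e₀ i ≡ true
        inNoCut i with lookup T i
        ... | false = refl
        ... | true rewrite separates-false⁺ (removeEdge T i ∪ C) e₀ (Path-mono (⊆-∪ʳ (removeEdge T i) C) p) = refl

      basis-Path-e₀ : ∀ T → T ⊆ S → isBasis S⁺ C T ≡ true → Path (T ∪ C) a b
      basis-Path-e₀ T T⊆S basis =
        components-≡⇒Path (∪-monoˡ {A = T} {A' = S⁺} C (⊆-trans {A = T} {B = S} {C = S⁺} T⊆S S⊆S⁺))
        (proj₂ (isBasis-true⁻ S⁺ C T basis)) (edgeₚ e₀ (⊆-∪ˡ S⁺ C e₀ (lookup-addEdge-self S e₀)))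

      e₀-not-externallyActive : ¬ Path C a b → ∀ T → T ⊆ S → isBasis S⁺ C T ≡ true →
        e₀-externallyActive T ≡ false
      e₀-not-externallyActive ¬p T T⊆S basis
        with allFinB m (λ i → lookup T i ⇒ᵇ connectedIn G (removeEdge T i ∪ C) a b) in avoidable
      ... | true = ⊥-elim (¬p (forest-Path-avoiding a b C T (λ e h → Disjoint-S-C e (T⊆S e h))
            (proj₁ (isBasis-true⁻ S⁺ C T basis)) (basis-Path-e₀ T T⊆S basis) λ i ti →
              subst (λ X → Path X a b) (removeEdge-∪ T C (Disjoint-S-C i (T⊆S i ti)))
                    (connectedIn⇒Path (⇒ᵇ-true⁻ (allFinB-true⁻ m _ avoidable i) ti))))
      ... | false with allFinB-false⁻ m _ avoidable
      ... | i , r with ⇒ᵇ-false⁻ r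
      ... | ti , cut = allFinB-false⁺ m _ i blocking
        where
        blocking : smallerInCycle C T e₀ i ≡ false
        blocking = trans (cong₂ (λ t s → (t ∧ s) ⇒ᵇ (rank i <ᵇ rank e₀)) ti (cong not cut))
                         (¬<ᵇe₀ i (T⊆S i ti))

      externalActivity-delete : ¬ Path C a b → ∀ T → T ⊆ S → isBasis S⁺ C T ≡ true →
        externalActivity S⁺ C T ≡ externalActivity S C T
      externalActivity-delete ¬p T T⊆S basis = countFin-cong m λ j → lemma j
        where
        lemma : ∀ j → externallyActive S⁺ C T j ≡ externallyActive S C T j
        lemma j with j ≟ e₀
        ... | yes refl = trans (externallyActive-e₀ T T⊆S)
                           (trans (e₀-not-externallyActive ¬p T T⊆S basis) (sym (externallyActive-S-e₀ T)))
        ... | no ne = externallyActive-other T ne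

      internallyActive-other : ∀ T → T ⊆ S → ∀ {i} → ¬ i ≡ e₀ →
        internallyActive S⁺ C (addEdge T e₀) i ≡ internallyActive S C⁺ T i
      internallyActive-other T T⊆S {i} ne =
        cong₂ _∧_ (lookup-addEdge-other T ne) (allFinB-cong m candidate)
        where
        candidate : ∀ j → smallerInCut S⁺ C (addEdge T e₀) i j ≡ smallerInCut S C⁺ T i j
        candidate j rewrite removeEdge-addEdge-∪ T ne with j ≟ e₀
        ... | yes refl rewrite e₀∈S⁺ | lookup-addEdge-self T e₀ | e₀∉S = refl
        ... | no nj rewrite lookup-addEdge-other S nj | lookup-addEdge-other T nj = refl

      internallyActive-C⁺-e₀ : ∀ T → T ⊆ S → internallyActive S C⁺ T e₀ ≡ false
      internallyActive-C⁺-e₀ T T⊆S rewrite e₀∉ {T} T⊆S = refl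

      e₀-internallyActive : EdgeSet m → Bool
      e₀-internallyActive T = allFinB m (λ j →
        (lookup S⁺ j ∧ (not (lookup (addEdge T e₀) j) ∧ separates (T ∪ C) j)) ⇒ᵇ (rank j <ᵇ rank e₀))

      internallyActive-e₀ : ∀ T → T ⊆ S → internallyActive S⁺ C (addEdge T e₀) e₀ ≡ e₀-internallyActive T
      internallyActive-e₀ T T⊆S rewrite lookup-addEdge-self T e₀ | removeEdge-addEdge T e₀ (e₀∉ {T} T⊆S) = refl

      -- Every other edge of S has larger rank, so e₀ can only be internally active if no edge of S
      -- crosses its fundamental cut, i.e. if e₀ is a coloop.
      e₀-internallyActive⇒coloop : ∀ T → T ⊆ S → isBasis S C⁺ T ≡ true → e₀-internallyActive T ≡ true →
        ¬ Path (S ∪ C) a b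
      e₀-internallyActive⇒coloop T T⊆S basis active p =
        proj₁ (isBasis-true⁻ S C⁺ T basis) e₀ (⊆-∪ʳ T C⁺ e₀ (lookup-addEdge-self C e₀))
          (Path-mono (⊆-removeEdge {A = T ∪ C} {B = T ∪ C⁺} (∪-monoʳ T (⊆-addEdge C e₀)) e₀∉T∪C)
                     (Path-reroute throughT p))
        where
        e₀∉T∪C : lookup (T ∪ C) e₀ ≡ false
        e₀∉T∪C = trans (lookup-∪ T C e₀) (cong₂ _∨_ (e₀∉ {T} T⊆S) e₀∉C)
        throughT : ∀ e → lookup (S ∪ C) e ≡ true → Path (T ∪ C) (ends₁ e) (ends₂ e)
        throughT e h with Path? (T ∪ C) (ends₁ e) (ends₂ e)
        ... | inj₁ q = q
        ... | inj₂ ¬q with ∨-true⁻ (trans (sym (lookup-∪ S C e)) h)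
        ... | inj₂ ce = ⊥-elim (¬q (edgeₚ e (⊆-∪ʳ T C e ce)))
        ... | inj₁ se with lookup T e in te
        ... | true  = ⊥-elim (¬q (edgeₚ e (⊆-∪ˡ T C e te)))
        ... | false = ⊥-elim (true≢false (⇒ᵇ-true⁻ (allFinB-true⁻ m _ active e) inCut) (¬<ᵇe₀ e se))
          where
          e≢e₀ : ¬ e ≡ e₀
          e≢e₀ refl = true≢false se e₀∉S
          inCut : (lookup S⁺ e ∧ (not (lookup (addEdge T e₀) e) ∧ separates (T ∪ C) e)) ≡ true
          inCut rewrite lookup-addEdge-other S e≢e₀ | lookup-addEdge-other T e≢e₀ | se | te
                      | separates-true⁺ (T ∪ C) e ¬q = refl

      coloop⇒e₀-internallyActive : ∀ T → T ⊆ S → isBasis S C⁺ T ≡ true → ¬ Path (S ∪ C) a b →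
        e₀-internallyActive T ≡ true
      coloop⇒e₀-internallyActive T T⊆S basis ¬p = allFinB-true⁺ m _ λ j → notInCut j
        where
        spanned : ∀ j → lookup S j ≡ true → Path (T ∪ C) (ends₁ j) (ends₂ j)
        spanned j sj with Path-addEdge⁻ (subst (λ X → Path X (ends₁ j) (ends₂ j)) (∪-addEdge T C e₀)
                           (components-≡⇒Path (∪-monoˡ {A = T} {A' = S} C⁺ T⊆S) (proj₂ (isBasis-true⁻ S C⁺ T basis))
                             (edgeₚ j (⊆-∪ˡ S C⁺ j sj))))
        ... | inj₁ q     = q
        ... | inj₂ cross =
          ⊥-elim (¬p (Crossing⇒Path (∪-monoˡ {A = T} {A' = S} C T⊆S) (edgeₚ j (⊆-∪ˡ S C j sj)) cross))
        notInCut : ∀ j → ((lookup S⁺ j ∧ (not (lookup (addEdge T e₀) j) ∧ separates (T ∪ C) j)) ⇒ᵇ (rank j <ᵇ rank e₀)) ≡ true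
        notInCut j with j ≟ e₀
        ... | yes refl rewrite e₀∈S⁺ | lookup-addEdge-self T e₀ = refl
        ... | no nj rewrite lookup-addEdge-other S nj | lookup-addEdge-other T nj with lookup S j in sj | lookup T j
        ... | false | _     = refl
        ... | true  | true  = refl
        ... | true  | false rewrite separates-false⁺ (T ∪ C) j (spanned j sj) = refl

      internalActivity-coloop : ¬ Path (S ∪ C) a b → ∀ T → T ⊆ S → isBasis S C⁺ T ≡ true →
        internalActivity S⁺ C (addEdge T e₀) ≡ suc (internalActivity S C⁺ T)
      internalActivity-coloop ¬p T T⊆S basis =
        countFin-insert m (internallyActive S C⁺ T) (internallyActive S⁺ C (addEdge T e₀)) e₀
          (λ i ne → sym (internallyActive-other T T⊆S ne)) (internallyActive-C⁺-e₀ T T⊆S)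
          (trans (internallyActive-e₀ T T⊆S) (coloop⇒e₀-internallyActive T T⊆S basis ¬p))

      internalActivity-contract : Path (S ∪ C) a b → ∀ T → T ⊆ S → isBasis S C⁺ T ≡ true →
        internalActivity S⁺ C (addEdge T e₀) ≡ internalActivity S C⁺ T
      internalActivity-contract p T T⊆S basis = countFin-cong m λ i → lemma i
        where
        lemma : ∀ i → internallyActive S⁺ C (addEdge T e₀) i ≡ internallyActive S C⁺ T i
        lemma i with i ≟ e₀
        ... | yes refl = trans (internallyActive-e₀ T T⊆S) (trans
                           (¬true⇒false λ active → e₀-internallyActive⇒coloop T T⊆S basis active p)
                           (sym (internallyActive-C⁺-e₀ T T⊆S)))
        ... | no ne = internallyActive-other T T⊆S ne

      externalActivity-contract : ∀ T → T ⊆ S → externalActivity S⁺ C (addEdge T e₀) ≡ externalActivity S C⁺ T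
      externalActivity-contract T T⊆S = countFin-cong m λ j → lemma j
        where
        lemma : ∀ j → externallyActive S⁺ C (addEdge T e₀) j ≡ externallyActive S C⁺ T j
        lemma j with j ≟ e₀
        ... | yes refl rewrite e₀∈S⁺ | lookup-addEdge-self T e₀ | e₀∉S = refl
        ... | no ne rewrite lookup-addEdge-other S ne | lookup-addEdge-other T ne with lookup S j in sj
        ... | false = refl
        ... | true  = cong (λ z → not (lookup T j) ∧ z) (allFinB-cong m λ i → candidate i)
          where
          candidate : ∀ i → smallerInCycle C (addEdge T e₀) j i
                          ≡ smallerInCycle C⁺ T j i
          candidate i with i ≟ e₀
          ... | yes refl rewrite e₀<ᵇ j sj | e₀∉ {T} T⊆S = ⇒ᵇ-zeroʳ _
          ... | no ni rewrite lookup-addEdge-other T ni | removeEdge-addEdge-∪ T ni = refl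

      isBasis-delete : Path (S ∪ C) a b → ∀ T → isBasis S⁺ C T ≡ isBasis S C T
      isBasis-delete p T = cong (λ k → isAcyclic G (T ∪ C) ∧ ⌊ components G (T ∪ C) ≟ℕ k ⌋) (components-S⁺ p)

      isBasis-contract : ∀ T → isBasis S⁺ C (addEdge T e₀) ≡ isBasis S C⁺ T
      isBasis-contract T =
        cong₂ (λ X k → isAcyclic G X ∧ ⌊ components G X ≟ℕ k ⌋) (addEdge-∪-swap T C e₀) components-S⁺-C⁺

      isBasis-coloop : ¬ Path (S ∪ C) a b → ∀ T → T ⊆ S → isBasis S⁺ C T ≡ false
      isBasis-coloop ¬p T T⊆S = trans (cong (isAcyclic G (T ∪ C) ∧_) (⌊≟ℕ⌋-false tooMany)) (∧-zeroʳ _)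
        where
        tooMany : ¬ components G (T ∪ C) ≡ components G (S⁺ ∪ C)
        tooMany eq = <-irrefl refl (≤-trans (≤-reflexive (sym (components-S⁺-coloop ¬p)))
                       (≤-trans (components-anti (∪-monoˡ {A = T} {A' = S} C T⊆S)) (≤-reflexive eq)))

      isBasis-loop : Path C a b → ∀ T → isBasis S C⁺ T ≡ false
      isBasis-loop p T = cong (_∧ ⌊ components G (T ∪ C⁺) ≟ℕ components G (S ∪ C⁺) ⌋) (¬true⇒false λ h →
        isAcyclic-true⁻ (T ∪ C⁺) h e₀ (⊆-∪ʳ T C⁺ e₀ (lookup-addEdge-self C e₀))
          (Path-mono (⊆-removeEdge {A = C} {B = T ∪ C⁺}
                       (⊆-trans {A = C} {B = C⁺} {C = T ∪ C⁺} (⊆-addEdge C e₀) (⊆-∪ʳ T C⁺)) e₀∉C) p))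

      activityWeight-delete : Path (S ∪ C) a b → ¬ Path C a b → ∀ T → T ⊆ S →
        activityWeight S⁺ C T ≡ activityWeight S C T
      activityWeight-delete p ¬p T T⊆S rewrite isBasis-delete p T with isBasis S C T in basis
      ... | true  rewrite internalActivity-delete T T⊆S
                        | externalActivity-delete ¬p T T⊆S (trans (isBasis-delete p T) basis) = refl
      ... | false = refl

      activityWeight-loop : Path C a b → ∀ T → T ⊆ S → activityWeight S⁺ C T ≡ y * activityWeight S C T
      activityWeight-loop p T T⊆S rewrite isBasis-delete (Path-mono (⊆-∪ʳ S C) p) T with isBasis S C T
      ... | true rewrite internalActivity-delete T T⊆S | externalActivity-loop p T T⊆S =
        solve 3 (λ X Y Z → X :* (Z :* Y) := Z :* (X :* Y)) refl
          (powℚ x (internalActivity S C T)) (powℚ y (externalActivity S C T)) y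
      ... | false = sym (*-zeroʳ y)

      activityWeight-coloop : ¬ Path (S ∪ C) a b → ∀ T → T ⊆ S → activityWeight S⁺ C T ≡ 0ℚ
      activityWeight-coloop ¬p T T⊆S rewrite isBasis-coloop ¬p T T⊆S = refl

      activityWeight-contract : Path (S ∪ C) a b → ∀ T → T ⊆ S →
        activityWeight S⁺ C (addEdge T e₀) ≡ activityWeight S C⁺ T
      activityWeight-contract p T T⊆S rewrite isBasis-contract T with isBasis S C⁺ T in basis
      ... | true rewrite internalActivity-contract p T T⊆S basis | externalActivity-contract T T⊆S = refl
      ... | false = refl

      activityWeight-contract-coloop : ¬ Path (S ∪ C) a b → ∀ T → T ⊆ S →
        activityWeight S⁺ C (addEdge T e₀) ≡ x * activityWeight S C⁺ T
      activityWeight-contract-coloop ¬p T T⊆S rewrite isBasis-contract T with isBasis S C⁺ T in basis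
      ... | true rewrite internalActivity-coloop ¬p T T⊆S basis | externalActivity-contract T T⊆S =
        solve 3 (λ X Y Z → (Z :* X) :* Y := Z :* (X :* Y)) refl
          (powℚ x (internalActivity S C⁺ T)) (powℚ y (externalActivity S C⁺ T)) x
      ... | false = sym (*-zeroʳ x)

      activityWeight-contract-loop : Path C a b → ∀ T → activityWeight S⁺ C (addEdge T e₀) ≡ 0ℚ
      activityWeight-contract-loop p T rewrite isBasis-contract T | isBasis-loop p T = refl

      private
        subsets : ∀ {F F' : EdgeSet m → ℚ} → (∀ A → A ⊆ S → F A ≡ F' A) → ∑⊆ S F ≡ ∑⊆ S F'
        subsets h = ∑⊆-cong S λ A st → h A (⊆ᵇ-true⁻ A S st)

      relTutte-loop : Path C a b → relTutte S⁺ C ≡ y * relTutte S C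
      relTutte-loop p = begin
        relTutte S⁺ C
          ≡⟨ ∑⊆-addEdge S e₀ e₀∉S (tutteTerm S⁺ C) ⟩
        ∑⊆ S (tutteTerm S⁺ C) + ∑⊆ S (λ A → tutteTerm S⁺ C (addEdge A e₀))
          ≡⟨ cong₂ _+_ (subsets λ A _ → tutteTerm-delete (Path-mono (⊆-∪ʳ S C) p) A)
                       (subsets λ A A⊆S → tutteTerm-loop p A (e₀∉ {A} A⊆S)) ⟩
        relTutte S C + ∑⊆ S (λ A → (y - 1ℚ) * tutteTerm S C A)
          ≡⟨ cong (relTutte S C +_) (∑⊆-*ˡ S (y - 1ℚ) (tutteTerm S C)) ⟩
        relTutte S C + (y - 1ℚ) * relTutte S C
          ≡⟨ solve 2 (λ Y t → t :+ (Y :- con 1ℚ) :* t := Y :* t) refl y (relTutte S C) ⟩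
        y * relTutte S C
          ∎
        where open ≡-Reasoning

      activityPolynomial-loop : Path C a b → activityPolynomial S⁺ C ≡ y * activityPolynomial S C
      activityPolynomial-loop p = begin
        activityPolynomial S⁺ C
          ≡⟨ ∑⊆-addEdge S e₀ e₀∉S (activityWeight S⁺ C) ⟩
        ∑⊆ S (activityWeight S⁺ C) + ∑⊆ S (λ T → activityWeight S⁺ C (addEdge T e₀))
          ≡⟨ cong₂ _+_ (subsets (activityWeight-loop p))
                       (trans (subsets λ T _ → activityWeight-contract-loop p T) (∑⊆-zero S)) ⟩
        ∑⊆ S (λ T → y * activityWeight S C T) + 0ℚ
          ≡⟨ +-identityʳ _ ⟩
        ∑⊆ S (λ T → y * activityWeight S C T)
          ≡⟨ ∑⊆-*ˡ S y (activityWeight S C) ⟩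
        y * activityPolynomial S C
          ∎
        where open ≡-Reasoning

      relTutte-ordinary : Path (S ∪ C) a b → ¬ Path C a b → relTutte S⁺ C ≡ relTutte S C + relTutte S C⁺
      relTutte-ordinary p ¬p = trans (∑⊆-addEdge S e₀ e₀∉S (tutteTerm S⁺ C))
        (cong₂ _+_ (subsets λ A _ → tutteTerm-delete p A)
                   (subsets λ A A⊆S → tutteTerm-contract ¬p A (e₀∉ {A} A⊆S)))

      activityPolynomial-ordinary : Path (S ∪ C) a b → ¬ Path C a b →
        activityPolynomial S⁺ C ≡ activityPolynomial S C + activityPolynomial S C⁺
      activityPolynomial-ordinary p ¬p = trans (∑⊆-addEdge S e₀ e₀∉S (activityWeight S⁺ C))
        (cong₂ _+_ (subsets (activityWeight-delete p ¬p)) (subsets (activityWeight-contract p)))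

      relTutte-coloop : ¬ Path (S ∪ C) a b → relTutte S⁺ C ≡ x * relTutte S C⁺
      relTutte-coloop ¬p = begin
        relTutte S⁺ C
          ≡⟨ ∑⊆-addEdge S e₀ e₀∉S (tutteTerm S⁺ C) ⟩
        ∑⊆ S (tutteTerm S⁺ C) + ∑⊆ S (λ A → tutteTerm S⁺ C (addEdge A e₀))
          ≡⟨ cong₂ _+_ (subsets (tutteTerm-coloop ¬p))
                       (subsets λ A A⊆S → tutteTerm-contract ¬pC A (e₀∉ {A} A⊆S)) ⟩
        ∑⊆ S (λ A → (x - 1ℚ) * tutteTerm S C⁺ A) + relTutte S C⁺
          ≡⟨ cong (_+ relTutte S C⁺) (∑⊆-*ˡ S (x - 1ℚ) (tutteTerm S C⁺)) ⟩
        (x - 1ℚ) * relTutte S C⁺ + relTutte S C⁺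
          ≡⟨ solve 2 (λ X t → (X :- con 1ℚ) :* t :+ t := X :* t) refl x (relTutte S C⁺) ⟩
        x * relTutte S C⁺
          ∎
        where
        open ≡-Reasoning
        ¬pC : ¬ Path C a b
        ¬pC pC = ¬p (Path-mono (⊆-∪ʳ S C) pC)

      activityPolynomial-coloop : ¬ Path (S ∪ C) a b → activityPolynomial S⁺ C ≡ x * activityPolynomial S C⁺
      activityPolynomial-coloop ¬p = begin
        activityPolynomial S⁺ C
          ≡⟨ ∑⊆-addEdge S e₀ e₀∉S (activityWeight S⁺ C) ⟩
        ∑⊆ S (activityWeight S⁺ C) + ∑⊆ S (λ T → activityWeight S⁺ C (addEdge T e₀))
          ≡⟨ cong₂ _+_ (trans (subsets (activityWeight-coloop ¬p)) (∑⊆-zero S))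
                       (subsets (activityWeight-contract-coloop ¬p)) ⟩
        0ℚ + ∑⊆ S (λ T → x * activityWeight S C⁺ T)
          ≡⟨ +-identityˡ _ ⟩
        ∑⊆ S (λ T → x * activityWeight S C⁺ T)
          ≡⟨ ∑⊆-*ˡ S x (activityWeight S C⁺) ⟩
        x * activityPolynomial S C⁺
          ∎
        where open ≡-Reasoning

      relTutte≡activityPolynomial-step :
        (∀ C' → Disjoint S C' → Acyclic C' → relTutte S C' ≡ activityPolynomial S C') →
        relTutte S⁺ C ≡ activityPolynomial S⁺ C
      relTutte≡activityPolynomial-step ih with Path? C a b | Path? (S ∪ C) a b
      ... | inj₁ pC  | _ = trans (relTutte-loop pC)
                             (trans (cong (y *_) (ih C Disjoint-S-C acyclicC)) (sym (activityPolynomial-loop pC)))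
      ... | inj₂ ¬pC | inj₁ p = trans (relTutte-ordinary p ¬pC)
                             (trans (cong₂ _+_ (ih C Disjoint-S-C acyclicC) (ih C⁺ Disjoint-S-C⁺ (Acyclic-addEdge C e₀ acyclicC ¬pC)))
                                    (sym (activityPolynomial-ordinary p ¬pC)))
      ... | inj₂ ¬pC | inj₂ ¬p = trans (relTutte-coloop ¬p)
                             (trans (cong (x *_) (ih C⁺ Disjoint-S-C⁺ (Acyclic-addEdge C e₀ acyclicC ¬pC)))
                                    (sym (activityPolynomial-coloop ¬p)))

    relTutte-∅ : ∀ C → relTutte ∅ C ≡ 1ℚ
    relTutte-∅ C = trans (∑⊆-∅ (tutteTerm ∅ C)) term
      where
      term : tutteTerm ∅ C ∅ ≡ 1ℚ
      term rewrite ∅-∪ C | size-∅ {m} | ℕ.+-identityʳ (components G C) | n∸n≡0 (components G C) = refl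

    activityPolynomial-∅ : ∀ C → Acyclic C → activityPolynomial ∅ C ≡ 1ℚ
    activityPolynomial-∅ C acyclic = trans (∑⊆-∅ (activityWeight ∅ C)) weight
      where
      basis : isBasis ∅ C ∅ ≡ true
      basis = ∧-true⁺ (trans (cong (isAcyclic G) (∅-∪ C)) (isAcyclic-true⁺ C acyclic))
                      (⌊≟ℕ⌋-refl (components G (∅ ∪ C)))
      noInternal : internalActivity ∅ C ∅ ≡ 0
      noInternal = countFin-none m _ λ i → ∧-false⁺ _ (lookup-∅ {m} i)
      noExternal : externalActivity ∅ C ∅ ≡ 0
      noExternal = countFin-none m _ λ j → ∧-false⁺ _ (lookup-∅ {m} j)
      weight : activityWeight ∅ C ∅ ≡ 1ℚ
      weight rewrite basis | noInternal | noExternal = refl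

    edgesFrom : ℕ → EdgeSet m
    edgesFrom t = tabulate (λ e → t ≤ᵇ rank e)

    lookup-edgesFrom : ∀ t e → lookup (edgesFrom t) e ≡ (t ≤ᵇ rank e)
    lookup-edgesFrom t e = lookup∘tabulate _ e

    edgesFrom-m : edgesFrom m ≡ ∅
    edgesFrom-m = EdgeSet-ext λ e → trans (lookup-edgesFrom m e)
      (trans (≤ᵇ-false⁺ λ le → <-irrefl refl (≤-trans (toℕ<n (lookup π e)) le)) (sym (lookup-∅ e)))

    edgesFrom-0 : edgesFrom 0 ≡ allEdges m
    edgesFrom-0 = EdgeSet-ext λ e → trans (lookup-edgesFrom 0 e) (sym (lookup-replicate e true))

    edgesFrom-suc : ∀ t e → ¬ rank e ≡ t → lookup (edgesFrom t) e ≡ lookup (edgesFrom (suc t)) e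
    edgesFrom-suc t e ne = trans (lookup-edgesFrom t e) (trans (Bool-ext
      (λ h → ≤ᵇ-true⁺ (≤∧≢⇒< (≤ᵇ-true⁻ h) λ t≡ → ne (sym t≡)))
      (λ h → ≤ᵇ-true⁺ (≤-trans (n≤1+n t) (≤ᵇ-true⁻ h)))) (sym (lookup-edgesFrom (suc t) e)))

    module _ (π-injective : Injective π) where

      edgesFrom-rank : ∀ t e₀ → rank e₀ ≡ t → edgesFrom t ≡ addEdge (edgesFrom (suc t)) e₀
      edgesFrom-rank t e₀ r≡t = EdgeSet-ext λ e → lemma e
        where
        lemma : ∀ e → lookup (edgesFrom t) e ≡ lookup (addEdge (edgesFrom (suc t)) e₀) e
        lemma e with e ≟ e₀
        ... | yes refl = trans (lookup-edgesFrom t e) (trans (≤ᵇ-true⁺ (≤-reflexive (sym r≡t)))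
                           (sym (lookup-addEdge-self (edgesFrom (suc t)) e)))
        ... | no ne = trans (edgesFrom-suc t e λ r≡ → ne (π-injective e e₀ (toℕ-injective (trans r≡ (sym r≡t)))))
                            (sym (lookup-addEdge-other (edgesFrom (suc t)) ne))

      relTutte≡activityPolynomial-from : ∀ j t → t +ℕ j ≡ m → ∀ C → Disjoint (edgesFrom t) C → Acyclic C →
        relTutte (edgesFrom t) C ≡ activityPolynomial (edgesFrom t) C
      relTutte≡activityPolynomial-from zero t t+0≡m C disjoint acyclic
        rewrite ℕ.+-identityʳ t | t+0≡m | edgesFrom-m = trans (relTutte-∅ C) (sym (activityPolynomial-∅ C acyclic))
      relTutte≡activityPolynomial-from (suc j) t t+j≡m C disjoint acyclic
        with anyFin m (λ e → ⌊ rank e ≟ℕ t ⌋) in found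
      ... | false =
        subst (λ S → relTutte S C ≡ activityPolynomial S C) (sym noRank)
          (relTutte≡activityPolynomial-from j (suc t) (trans (sym (ℕ.+-suc t j)) t+j≡m) C
            (subst (λ S → Disjoint S C) noRank disjoint) acyclic)
        where
        noRank : edgesFrom t ≡ edgesFrom (suc t)
        noRank = EdgeSet-ext λ e → edgesFrom-suc t e λ r≡t →
          true≢false (anyFin-true⁺ m _ e (subst (λ k → ⌊ rank e ≟ℕ k ⌋ ≡ true) r≡t (⌊≟ℕ⌋-refl (rank e))))
                     found
      ... | true with anyFin-true⁻ m _ found
      ... | e₀ , r≡t with refl ← ⌊≟ℕ⌋-true⁻ r≡t =
        subst (λ S → relTutte S C ≡ activityPolynomial S C) (sym (edgesFrom-rank (rank e₀) e₀ refl))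
          (DeletionContraction.relTutte≡activityPolynomial-step (edgesFrom (suc (rank e₀))) e₀ e₀∉ e₀-min C
            (subst (λ S → Disjoint S C) (edgesFrom-rank (rank e₀) e₀ refl) disjoint) acyclic
            (relTutte≡activityPolynomial-from j (suc (rank e₀)) (trans (sym (ℕ.+-suc (rank e₀) j)) t+j≡m)))
        where
        e₀∉ : lookup (edgesFrom (suc (rank e₀))) e₀ ≡ false
        e₀∉ = trans (lookup-edgesFrom (suc (rank e₀)) e₀) (≤ᵇ-false⁺ (<-irrefl {rank e₀} refl))
        e₀-min : ∀ e → lookup (edgesFrom (suc (rank e₀))) e ≡ true → rank e₀ < rank e
        e₀-min e h = ≤ᵇ-true⁻ (trans (sym (lookup-edgesFrom (suc (rank e₀)) e)) h)

      relTutte≡activityPolynomial : relTutte (allEdges m) ∅ ≡ activityPolynomial (allEdges m) ∅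
      relTutte≡activityPolynomial = subst (λ S → relTutte S ∅ ≡ activityPolynomial S ∅) edgesFrom-0
        (relTutte≡activityPolynomial-from m 0 refl ∅ (λ e _ → lookup-∅ e) Acyclic-∅)

  module _ (x y : ℚ) where

    tutte≡relTutte : ∀ π → tutte G x y ≡ ActivityExpansion.relTutte π x y (allEdges m) ∅
    tutte≡relTutte π = ∑-cong (allEdgeSets m) λ A → sym (term A)
      where
      open ActivityExpansion π x y
      term : ∀ A → (if A ⊆ᵇ allEdges m then tutteTerm (allEdges m) ∅ A else 0ℚ)
                 ≡ powℚ (x - 1ℚ) (components G A ∸ components G (allEdges m))
                   * powℚ (y - 1ℚ) ((components G A +ℕ size A) ∸ n)
      term A rewrite ⊆ᵇ-true⁺ A (allEdges m) (λ e _ → lookup-replicate e true)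
                   | ∪-∅ A | ∪-∅ (allEdges m) | components-∅ = refl

    activityWeightOf : Vec (Fin m) m → EdgeSet m → ℚ
    activityWeightOf π T = powℚ x (ia (exchangeGraph G T) π) * powℚ y (ea (exchangeGraph G T) π)

    activityPolynomial≡∑spanningTrees : components G (allEdges m) ≡ 1 → ∀ π →
      ActivityExpansion.activityPolynomial π x y (allEdges m) ∅ ≡ ∑ (spanningTrees G) (activityWeightOf π)
    activityPolynomial≡∑spanningTrees connected π =
      trans (∑-cong (allEdgeSets m) term) (sym (∑-filter (isSpanningTree G) (allEdgeSets m) (activityWeightOf π)))
      where
      open ActivityExpansion π x y
      isBasis≡isSpanningTree : ∀ T → isBasis (allEdges m) ∅ T ≡ isSpanningTree G T
      isBasis≡isSpanningTree T rewrite ∪-∅ T | ∪-∅ (allEdges m) | connected = ∧-comm (isAcyclic G T) _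
      internalActivity≡ia : ∀ T → internalActivity (allEdges m) ∅ T ≡ ia (exchangeGraph G T) π
      internalActivity≡ia T = countFin-cong m λ i → ∧-cong-when (lookup T i) λ ti → allFinB-cong m (candidate i ti)
        where
        candidate : ∀ i → lookup T i ≡ true → ∀ j →
          smallerInCut (allEdges m) ∅ T i j
          ≡ ((not (lookup T j) ∧ adj (exchangeGraph G T) i j) ⇒ᵇ (rank j <ᵇ rank i))
        candidate i ti j rewrite ti | lookup-replicate j true | ∪-∅ (removeEdge T i) with lookup T j
        ... | true  = refl
        ... | false = refl
      externalActivity≡ea : ∀ T → externalActivity (allEdges m) ∅ T ≡ ea (exchangeGraph G T) π
      externalActivity≡ea T = countFin-cong m λ j → trans
        (cong (_∧ (not (lookup T j) ∧ allFinB m (smallerInCycle ∅ T j)))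
              (lookup-replicate j true))
        (∧-cong-when (not (lookup T j)) λ tj → allFinB-cong m (candidate j tj))
        where
        candidate : ∀ j → not (lookup T j) ≡ true → ∀ i →
          smallerInCycle ∅ T j i
          ≡ ((lookup T i ∧ adj (exchangeGraph G T) i j) ⇒ᵇ (rank i <ᵇ rank j))
        candidate j tj i rewrite not-true⁻ tj | ∪-∅ (removeEdge T i) with lookup T i
        ... | true  = refl
        ... | false = refl
      term : ∀ T → (if T ⊆ᵇ allEdges m then activityWeight (allEdges m) ∅ T else 0ℚ)
                 ≡ (if isSpanningTree G T then activityWeightOf π T else 0ℚ)
      term T rewrite ⊆ᵇ-true⁺ T (allEdges m) (λ e _ → lookup-replicate e true) | sym (isBasis≡isSpanningTree T)
        with isBasis (allEdges m) ∅ T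
      ... | true rewrite internalActivity≡ia T | externalActivity≡ea T = refl
      ... | false = refl

    tutte-activityExpansion : components G (allEdges m) ≡ 1 → ∀ π → isPerm π ≡ true →
      tutte G x y ≡ ∑ (spanningTrees G) (activityWeightOf π)
    tutte-activityExpansion connected π perm = begin
      tutte G x y                       ≡⟨ tutte≡relTutte π ⟩
      relTutte (allEdges m) ∅           ≡⟨ relTutte≡activityPolynomial π-injective ⟩
      activityPolynomial (allEdges m) ∅ ≡⟨ activityPolynomial≡∑spanningTrees connected π ⟩
      ∑ (spanningTrees G) (activityWeightOf π) ∎
      where
      open ≡-Reasoning
      open ActivityExpansion π x y
      π-injective : Injective π
      π-injective = injective?-true⁻ π (trans (sym (isPerm≡injective? π)) perm)

mainTheorem3 : (n m : ℕ) (G : Graph n m) → components G (allEdges m) ≡ 1 →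
    (x y : ℚ) →
    tutte G x y ≡ sumℚ (map (λ T → tutteTilde (exchangeGraph G T) x y) (spanningTrees G))
mainTheorem3 n m G connected x y = sym (begin
  ∑ (spanningTrees G) (λ T → 1/m! * ∑ (permutations m) (λ π → activityWeightOf G x y π T))
    ≡⟨ ∑-*ˡ (spanningTrees G) 1/m! _ ⟩
  1/m! * ∑ (spanningTrees G) (λ T → ∑ (permutations m) (λ π → activityWeightOf G x y π T))
    ≡⟨ cong (1/m! *_) (∑-swap (spanningTrees G) (permutations m) _) ⟩
  1/m! * ∑ (permutations m) (λ π → ∑ (spanningTrees G) (activityWeightOf G x y π))
    ≡⟨ cong (1/m! *_) (∑-filter-cong isPerm (allVecs (allFin m) m) λ π perm →
                         sym (tutte-activityExpansion G x y connected π perm)) ⟩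
  1/m! * ∑ (permutations m) (λ _ → tutte G x y)
    ≡⟨ cong (1/m! *_) (∑-permutations m (tutte G x y)) ⟩
  1/m! * ((m !) · tutte G x y)
    ≡⟨ average-constant (m !) {{m !≢0}} (tutte G x y) ⟩
  tutte G x y
    ∎)
  where
  open ≡-Reasoning
  1/m! : ℚ
  1/m! = (ℤ.+ 1 / (m !)) {{m !≢0}}
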